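{- Let $M$ and $N$ be matroids on disjoint finite sets $S$ and $T$, let $A\subseteq S$, $B\subseteq T$, and let $P=(M,N;A,B)$. The cyclic flats of $P$ are exactly the sets of the following three kinds: (1) $Z_M\cup Z_N$ where $Z_M$ is a cyclic flat of $M$, $A\not\subseteq Z_M$, and $Z_N$ is a cyclic flat of $N\setminus B$; (2) $F_M\cup Z_N$ where $F_M$ is a flat of $M$, $A\subseteq F_M$, all coloops of the restriction $M|F_M$ are in $A$, $Z_N$ is a cyclic flat of $N$, and $Z_N\cap B\neq\emptyset$; (3) $Z_M\cup Z_N$ where $Z_M$ is a cyclic flat of $M$, $A\subseteq Z_M$, $Z_N$ is a cyclic flat of $N$, and $Z_N\cap B=\emptyset$.
   Context: A set in a matroid is cyclic if it is a (possibly empty) union of circuits; a cyclic flat is a flat that is cyclic. The principal sum $(M,N;A,B)$ is the matroid union $M^+(A,B)\vee N_0$, where: $N_0=N\oplus U_{0,S}$ ($N$ with the elements of $S$ added as loops); $M^+(A,B)$ is the matroid on $S\cup T$ obtained from $M$ by adding each element of $B$ freely (by successive principal extensions) to the flat $\mathrm{cl}_M(A)$ and each element of $T-B$ as a loop, equivalently the matroid with rank function $r(X\cup Y)=\min\{r_M(X\cup A),\,r_M(X)+|Y\cap B|\}$ for $X\subseteq S$, $Y\subseteq T$; and the matroid union $G\vee H$ of matroids on a common set has as independent sets the unions of an independent set of $G$ and an independent set of $H$. -}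

module Defs where

open import Data.Nat using (ℕ; _+_; _≤_; _<_)
open import Data.Fin using (Fin)
open import Data.Fin.Subset using (Subset; _∪_; _∩_; _⊆_; _∈_; _∉_; ⁅_⁆; ∣_∣; ⊥; ⊤; ∁)
open import Data.Vec using (_++_; take; drop)
open import Data.Product using (Σ; ∃; ∃-syntax; _×_; _,_)
open import Relation.Nullary using (¬_; Dec)
open import Relation.Binary.PropositionalEquality using (_≡_; _≢_)

module _ {k : ℕ} (Ind : Subset k → Set) where

  IsRank : Subset k → ℕ → Set
  IsRank X j = (∃[ I ] (I ⊆ X × Ind I × ∣ I ∣ ≡ j))
             × (∀ I → I ⊆ X → Ind I → ∣ I ∣ ≤ j)

  Circuit : Subset k → Set
  Circuit C = ¬ Ind C × (∀ D → D ⊆ C → D ≢ C → Ind D)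

  Cyclic : Subset k → Set
  Cyclic X = ∀ x → x ∈ X → ∃[ C ] (Circuit C × C ⊆ X × x ∈ C)

  FlatIn : Subset k → Subset k → Set
  FlatIn E X = X ⊆ E × (∀ x → x ∈ E → x ∉ X → ∀ j j' →
                 IsRank X j → IsRank (X ∪ ⁅ x ⁆) j' → j < j')

  Flat : Subset k → Set
  Flat X = FlatIn ⊤ X

  -- cyclic flat of the restriction to E (circuits of M|E are the circuits of M inside E)
  CyclicFlatIn : Subset k → Subset k → Set
  CyclicFlatIn E X = FlatIn E X × Cyclic X

  CyclicFlat : Subset k → Set
  CyclicFlat X = CyclicFlatIn ⊤ X

  ColoopIn : Subset k → Fin k → Set
  ColoopIn F x = x ∈ F × (∀ C → Circuit C → C ⊆ F → x ∉ C)

record Matroid (k : ℕ) : Set₁ where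
  field
    Indep     : Subset k → Set
    indep?    : ∀ X → Dec (Indep X)
    indep-∅   : Indep ⊥
    indep-⊆   : ∀ {I J} → J ⊆ I → Indep I → Indep J
    indep-aug : ∀ {I J} → Indep I → Indep J → ∣ I ∣ < ∣ J ∣ →
                ∃[ x ] (x ∈ J × x ∉ I × Indep (I ∪ ⁅ x ⁆))

open Matroid public

-- Ground set S ∪ T is Fin (m + n): the first m elements are S, the last n are T.
-- A subset of S ∪ T is X ++ Y with X ⊆ S, Y ⊆ T.
module _ {m n : ℕ} (M : Matroid m) (N : Matroid n) (A : Subset m) (B : Subset n) where

  -- M⁺(A,B): rank r(X ∪ Y) = min { r_M(X ∪ A), r_M(X) + |Y ∩ B| };
  -- a set is independent iff its rank equals its size.
  IndepM⁺ : Subset (m + n) → Set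
  IndepM⁺ Z = ∀ j₁ j₂ → IsRank (Indep M) (X ∪ A) j₁ → IsRank (Indep M) X j₂ →
              (∣ X ∣ + ∣ Y ∣ ≤ j₁) × (∣ X ∣ + ∣ Y ∣ ≤ j₂ + ∣ Y ∩ B ∣)
    where
      X = take m Z
      Y = drop m Z

  -- N₀ = N ⊕ U_{0,S}
  IndepN₀ : Subset (m + n) → Set
  IndepN₀ Z = take m Z ≡ ⊥ × Indep N (drop m Z)

  -- principal sum P = M⁺(A,B) ∨ N₀ (matroid union)
  IndepP : Subset (m + n) → Set
  IndepP Z = ∃[ I₁ ] ∃[ I₂ ] (IndepM⁺ I₁ × IndepN₀ I₂ × Z ≡ I₁ ∪ I₂)

module Submission where

-- We first compute the rank of P: for F ⊆ S and G ⊆ T,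
--   r_P(F ∪ G) = min(α, β),  α = r_M(F) + r_N(G - B) + |G ∩ B|,  β = r_M(F ∪ A) + r_N(G),
-- by exhibiting an independent set of that size and bounding every other one.
-- From α and β being monotone and submodular with α - β monotone we get that
-- deleting an element of a circuit of P never lowers this rank.  Cyclic flats
-- can then be described purely by rank: Z = F ++ G is a cyclic flat of P iff
-- deleting any element keeps min(α, β) and adding any element raises it.  A
-- case analysis on whether G meets B (then β < α and the second kind arises)
-- or not (then α ≤ β, and A ⊆ F separates the third kind from the first)
-- turns these rank conditions into the three kinds of the theorem.

open import Defs
open import Data.Nat using (ℕ; zero; suc; _+_; _≤_; _<_; z≤n; s≤s; _⊓_; _∸_; _≤?_)
open import Data.Nat.Properties hiding (_≟_)
open import Data.Nat.Solver using (module +-*-Solver)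
open import Data.Bool using (true; false)
open import Data.Fin using (Fin; zero; suc; _↑ˡ_; _↑ʳ_)
open import Data.Fin.Properties using (any?; _≟_)
import Data.Fin.Properties as FinP
open import Data.Fin.Subset
open import Data.Fin.Subset.Properties
open import Data.Vec using ([]; _∷_; _++_; take; drop; here; there)
open import Data.Vec.Properties using (take-zipWith; drop-zipWith; take++drop≡id)
open import Data.Product using (∃-syntax; _×_; _,_; proj₁; proj₂)
open import Data.Sum using (_⊎_; inj₁; inj₂; [_,_]′)
open import Data.Empty using (⊥-elim)
open import Function.Bundles using (_⇔_; mk⇔; Equivalence)
open import Relation.Nullary using (¬_; Dec; yes; no; contradiction)
open import Relation.Nullary.Decidable using (_×-dec_; ¬?; decidable-stable)
open import Relation.Binary.PropositionalEquality
open import Algebra.Properties.CommutativeSemigroup +-commutativeSemigroup using (interchange)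

+-mono-≤₂ : ∀ {a₁ a₂ a₃ a₄ b₁ b₂ b₃ b₄} → a₁ + a₂ ≤ a₃ + a₄ → b₁ + b₂ ≤ b₃ + b₄ →
            (a₁ + b₁) + (a₂ + b₂) ≤ (a₃ + b₃) + (a₄ + b₄)
+-mono-≤₂ {a₁} {a₂} {a₃} {a₄} {b₁} {b₂} {b₃} {b₄} p q =
  subst₂ _≤_ (interchange a₁ a₂ b₁ b₂) (interchange a₃ a₄ b₃ b₄) (+-mono-≤ p q)

-- The key inequality behind "deleting an element of a circuit does not lower
-- the rank" for a rank of the form min(α, β).  Read aX, bX as α(X), β(X) for
-- U = C - e ⊆ C, U ⊆ V = Z - e: the hypotheses are monotonicity on U ⊆ C,
-- diminishing returns for adding e to U ⊆ V, monotonicity of α - β, and the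
-- circuit property min(α,β)(C - e) = min(α,β)(C).
min-rank-step : ∀ {aU aC aV aZ bU bC bV bZ} → aU ≤ aC → bU ≤ bC →
  aZ + aU ≤ aV + aC → bZ + bU ≤ bV + bC →
  aU + bV ≤ aV + bU → aU + bC ≤ aC + bU → aU ⊓ bU ≡ aC ⊓ bC →
  aZ ⊓ bZ ≤ aV ⊓ bV
min-rank-step {aU} {aC} {aV} {aZ} {bU} {bC} {bV} {bZ} aUC bUC da db mV mC eq
  with ≤-total aV bV
... | inj₁ aV≤bV = subst (aZ ⊓ bZ ≤_) (sym (m≤n⇒m⊓n≡m aV≤bV)) (≮⇒≥ contra)
  where
  -- if α(V) < min(α,β)(Z), then e raises α on U, so the circuit value is β(C),
  -- β cannot grow from V to Z, and monotonicity of α - β gives β(V) ≤ α(V).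
  contra : ¬ (aV < aZ ⊓ bZ)
  contra lt = <⇒≱ aV<bV bV≤aV
    where
    aU<aC : aU < aC
    aU<aC = ≰⇒> λ aC≤aU → <⇒≱ (<-≤-trans lt (m⊓n≤m aZ bZ))
              (+-cancelʳ-≤ aU aZ aV (≤-trans da (+-monoʳ-≤ aV aC≤aU)))
    c≡bC : aC ⊓ bC ≡ bC
    c≡bC with ⊓-sel aC bC
    ... | inj₁ e = ⊥-elim (<⇒≱ aU<aC (≤-trans (≤-reflexive (trans (sym e) (sym eq))) (m⊓n≤m aU bU)))
    ... | inj₂ e = e
    bC≤uU : bC ≤ aU ⊓ bU
    bC≤uU = ≤-reflexive (trans (sym c≡bC) (sym eq))
    aV<bV : aV < bV
    aV<bV = <-≤-trans (<-≤-trans lt (m⊓n≤n aZ bZ))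
              (+-cancelʳ-≤ bU bZ bV (≤-trans db (+-monoʳ-≤ bV (≤-trans bC≤uU (m⊓n≤n aU bU)))))
    bV≤aV : bV ≤ aV
    bV≤aV = +-cancelˡ-≤ aU bV aV (≤-trans mV (≤-trans
              (+-monoʳ-≤ aV (≤-trans bUC (≤-trans bC≤uU (m⊓n≤m aU bU)))) (≤-reflexive (+-comm aV aU))))
... | inj₂ bV≤aV = subst (aZ ⊓ bZ ≤_) (sym (m≥n⇒m⊓n≡n bV≤aV)) (≮⇒≥ contra)
  where
  -- symmetrically, if β(V) < min(α,β)(Z) then β grows on U ⊆ C, the circuit
  -- value is α(C), and monotonicity of α - β forces β(C) ≤ β(U).
  contra : ¬ (bV < aZ ⊓ bZ)
  contra lt = <⇒≱ bU<bC bC≤bU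
    where
    bU<bC : bU < bC
    bU<bC = ≰⇒> λ bC≤bU → <⇒≱ (<-≤-trans lt (m⊓n≤n aZ bZ))
              (+-cancelʳ-≤ bU bZ bV (≤-trans db (+-monoʳ-≤ bV bC≤bU)))
    c≡aC : aC ⊓ bC ≡ aC
    c≡aC with ⊓-sel aC bC
    ... | inj₁ e = e
    ... | inj₂ e = ⊥-elim (<⇒≱ bU<bC (≤-trans (≤-reflexive (trans (sym e) (sym eq))) (m⊓n≤n aU bU)))
    aC≤aU : aC ≤ aU
    aC≤aU = ≤-trans (≤-reflexive (trans (sym c≡aC) (sym eq))) (m⊓n≤m aU bU)
    bC≤bU : bC ≤ bU
    bC≤bU = +-cancelˡ-≤ aU bC bU (≤-trans mC (+-monoˡ-≤ bU aC≤aU))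

private variable
  k : ℕ

x∈p─q⁻ : ∀ {x : Fin k} (p q : Subset k) → x ∈ p ─ q → x ∈ p × x ∉ q
x∈p─q⁻ (true ∷ p) (false ∷ q) here = here , λ ()
x∈p─q⁻ {x = zero} (false ∷ p) (false ∷ q) ()
x∈p─q⁻ {x = zero} (false ∷ p) (true ∷ q) ()
x∈p─q⁻ {x = zero} (true ∷ p) (true ∷ q) ()
x∈p─q⁻ (_ ∷ p) (_ ∷ q) (there h) with x∈p─q⁻ p q h
... | x∈p , x∉q = there x∈p , λ { (there x∈q) → x∉q x∈q }

x∈p-y⁻ : ∀ {x y : Fin k} (p : Subset k) → x ∈ p - y → x ∈ p × x ≢ y
x∈p-y⁻ {y = y} p h with x∈p─q⁻ p ⁅ y ⁆ h
... | x∈p , x∉y = x∈p , λ { refl → x∉y (x∈⁅x⁆ y) }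

x∉p-x : ∀ {x : Fin k} (p : Subset k) → x ∉ p - x
x∉p-x p h = proj₂ (x∈p-y⁻ p h) refl

⊈⇒witness : (p q : Subset k) → ¬ (p ⊆ q) → ∃[ x ] (x ∈ p × x ∉ q)
⊈⇒witness p q p⊈q with any? (λ y → (y ∈? p) ×-dec ¬? (y ∈? q))
... | yes w = w
... | no ne = ⊥-elim (p⊈q λ {y} y∈p → decidable-stable (y ∈? q) λ y∉q → ne (y , y∈p , y∉q))

∪-mono : {X X' Y Y' : Subset k} → X ⊆ X' → Y ⊆ Y' → X ∪ Y ⊆ X' ∪ Y'
∪-mono {X = X} {Y = Y} a b h with x∈p∪q⁻ X Y h
... | inj₁ h' = x∈p∪q⁺ (inj₁ (a h'))
... | inj₂ h' = x∈p∪q⁺ (inj₂ (b h'))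

∩-mono : {X X' Y Y' : Subset k} → X ⊆ X' → Y ⊆ Y' → X ∩ Y ⊆ X' ∩ Y'
∩-mono {X = X} {Y = Y} a b h with x∈p∩q⁻ X Y h
... | h₁ , h₂ = x∈p∩q⁺ (a h₁ , b h₂)

∪-lub : {X Y W : Subset k} → X ⊆ W → Y ⊆ W → X ∪ Y ⊆ W
∪-lub {X = X} {Y = Y} a b h with x∈p∪q⁻ X Y h
... | inj₁ h' = a h'
... | inj₂ h' = b h'

∩-distribʳ-∩ : (X Y W : Subset k) → (X ∩ Y) ∩ W ⊆ (X ∩ W) ∩ (Y ∩ W)
∩-distribʳ-∩ X Y W h with x∈p∩q⁻ (X ∩ Y) W h
... | a , b with x∈p∩q⁻ X Y a
... | a₁ , a₂ = x∈p∩q⁺ (x∈p∩q⁺ (a₁ , b) , x∈p∩q⁺ (a₂ , b))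

⊆-del-add : (X : Subset k) (e : Fin k) → X ⊆ (X - e) ∪ ⁅ e ⁆
⊆-del-add X e {z} h with z ≟ e
... | yes refl = x∈p∪q⁺ (inj₂ (x∈⁅x⁆ e))
... | no z≢e = x∈p∪q⁺ (inj₁ (x∈p∧x≢y⇒x∈p-y h z≢e))

∣p∣≥∣q∣⇒q⊆p : {p q : Subset k} → p ⊆ q → ∣ q ∣ ≤ ∣ p ∣ → q ⊆ p
∣p∣≥∣q∣⇒q⊆p {p = p} {q} p⊆q le {x} x∈q with any? (λ y → (y ∈? q) ×-dec ¬? (y ∈? p))
... | yes (y , y∈q , y∉p) = ⊥-elim (<⇒≱ (p⊂q⇒∣p∣<∣q∣ (p⊆q , y , y∈q , y∉p)) le)
... | no ne = decidable-stable (x ∈? p) λ x∉p → ne (x , x∈q , x∉p)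

∣p∣≥∣q∣⇒p≡q : {p q : Subset k} → p ⊆ q → ∣ q ∣ ≤ ∣ p ∣ → p ≡ q
∣p∣≥∣q∣⇒p≡q p⊆q le = ⊆-antisym p⊆q (∣p∣≥∣q∣⇒q⊆p p⊆q le)

∣-∣-cong : {p q : Subset k} → p ⊆ q → q ⊆ p → ∣ p ∣ ≡ ∣ q ∣
∣-∣-cong p⊆q q⊆p = cong ∣_∣ (⊆-antisym p⊆q q⊆p)

∣p∪q∣+∣p∩q∣ : (p q : Subset k) → ∣ p ∪ q ∣ + ∣ p ∩ q ∣ ≡ ∣ p ∣ + ∣ q ∣
∣p∪q∣+∣p∩q∣ [] [] = refl
∣p∪q∣+∣p∩q∣ (true ∷ p) (true ∷ q) =
  cong suc (trans (+-suc _ _) (trans (cong suc (∣p∪q∣+∣p∩q∣ p q)) (sym (+-suc _ _))))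
∣p∪q∣+∣p∩q∣ (true ∷ p) (false ∷ q) = cong suc (∣p∪q∣+∣p∩q∣ p q)
∣p∪q∣+∣p∩q∣ (false ∷ p) (true ∷ q) = trans (cong suc (∣p∪q∣+∣p∩q∣ p q)) (sym (+-suc _ _))
∣p∪q∣+∣p∩q∣ (false ∷ p) (false ∷ q) = ∣p∪q∣+∣p∩q∣ p q

∣p∣-split : (p q : Subset k) → ∣ p ∣ ≡ ∣ p ∩ q ∣ + ∣ p ∩ ∁ q ∣
∣p∣-split [] [] = refl
∣p∣-split (true ∷ p) (true ∷ q) = cong suc (∣p∣-split p q)
∣p∣-split (true ∷ p) (false ∷ q) = trans (cong suc (∣p∣-split p q)) (sym (+-suc _ _))
∣p∣-split (false ∷ p) (true ∷ q) = ∣p∣-split p q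
∣p∣-split (false ∷ p) (false ∷ q) = ∣p∣-split p q

∣p∪q∣≤∣p∣+∣q∣ : (p q : Subset k) → ∣ p ∪ q ∣ ≤ ∣ p ∣ + ∣ q ∣
∣p∪q∣≤∣p∣+∣q∣ p q = subst (∣ p ∪ q ∣ ≤_) (∣p∪q∣+∣p∩q∣ p q) (m≤m+n _ _)

∣p∪q∣≡∣p∣+∣q∣ : (p q : Subset k) → (∀ x → x ∈ p → x ∉ q) → ∣ p ∪ q ∣ ≡ ∣ p ∣ + ∣ q ∣
∣p∪q∣≡∣p∣+∣q∣ {k} p q disjoint = begin
  ∣ p ∪ q ∣                ≡⟨ sym (+-identityʳ _) ⟩
  ∣ p ∪ q ∣ + 0             ≡⟨ cong (∣ p ∪ q ∣ +_) (sym (∣⊥∣≡0 k)) ⟩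
  ∣ p ∪ q ∣ + ∣ ⊥ {k} ∣     ≡⟨ cong (λ s → ∣ p ∪ q ∣ + ∣ s ∣) (sym p∩q≡⊥) ⟩
  ∣ p ∪ q ∣ + ∣ p ∩ q ∣     ≡⟨ ∣p∪q∣+∣p∩q∣ p q ⟩
  ∣ p ∣ + ∣ q ∣ ∎
  where
  open ≡-Reasoning
  p∩q≡⊥ : p ∩ q ≡ ⊥
  p∩q≡⊥ = Empty-unique λ { (x , h) → let a , b = x∈p∩q⁻ p q h in disjoint x a b }

∣p∪⁅x⁆∣ : ∀ {x : Fin k} (p : Subset k) → x ∉ p → ∣ p ∪ ⁅ x ⁆ ∣ ≡ suc ∣ p ∣
∣p∪⁅x⁆∣ {x = x} p x∉p =
  trans (∣p∪q∣≡∣p∣+∣q∣ p ⁅ x ⁆ λ y y∈p y∈x → x∉p (subst (_∈ p) (x∈⁅y⁆⇒x≡y x y∈x) y∈p))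
        (trans (cong (∣ p ∣ +_) (∣⁅x⁆∣≡1 x)) (+-comm _ 1))

∣p-x∣ : ∀ {x : Fin k} (p : Subset k) → x ∈ p → suc ∣ p - x ∣ ≡ ∣ p ∣
∣p-x∣ {x = x} p x∈p = trans (sym (∣p∪⁅x⁆∣ (p - x) (x∉p-x p)))
  (∣-∣-cong (∪-lub (p─q⊆p p ⁅ x ⁆) (λ h → subst (_∈ p) (sym (x∈⁅y⁆⇒x≡y x h)) x∈p))
            (⊆-del-add p x))

⊆-of-size : (U : Subset k) (j : ℕ) → j ≤ ∣ U ∣ → ∃[ V ] (V ⊆ U × ∣ V ∣ ≡ j)
⊆-of-size {k} U zero _ = ⊥ , (λ h → contradiction h ∉⊥) , ∣⊥∣≡0 k
⊆-of-size (true ∷ U) (suc j) (s≤s le) with ⊆-of-size U j le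
... | V , V⊆U , ∣V∣ = (true ∷ V) , (λ { here → here ; (there h) → there (V⊆U h) }) , cong suc ∣V∣
⊆-of-size (false ∷ U) (suc j) le with ⊆-of-size U (suc j) le
... | V , V⊆U , ∣V∣ = (false ∷ V) , (λ { (there h) → there (V⊆U h) }) , ∣V∣

∣X++Y∣ : ∀ {m n} (X : Subset m) (Y : Subset n) → ∣ X ++ Y ∣ ≡ ∣ X ∣ + ∣ Y ∣
∣X++Y∣ [] Y = refl
∣X++Y∣ (true ∷ X) Y = cong suc (∣X++Y∣ X Y)
∣X++Y∣ (false ∷ X) Y = ∣X++Y∣ X Y

++-mono : ∀ {m n} {X X' : Subset m} {Y Y' : Subset n} → X ⊆ X' → Y ⊆ Y' → X ++ Y ⊆ X' ++ Y'
++-mono {X = []} {[]} _ Y⊆Y' h = Y⊆Y' h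
++-mono {X = _ ∷ X} {_ ∷ X'} X⊆X' Y⊆Y' here with X⊆X' (here {xs = X})
... | here = here
++-mono {X = _ ∷ X} {_ ∷ X'} X⊆X' Y⊆Y' (there h) =
  there (++-mono (λ z → drop-there (X⊆X' (there z))) Y⊆Y' h)

take-++ : ∀ {m n} (X : Subset m) (Y : Subset n) → take m (X ++ Y) ≡ X
take-++ [] Y = refl
take-++ (x ∷ X) Y = cong (x ∷_) (take-++ X Y)

drop-++ : ∀ {m n} (X : Subset m) (Y : Subset n) → drop m (X ++ Y) ≡ Y
drop-++ [] Y = refl
drop-++ (x ∷ X) Y = drop-++ X Y

∈++ˡ⁺ : ∀ {m n} {i : Fin m} (X : Subset m) (Y : Subset n) → i ∈ X → i ↑ˡ n ∈ X ++ Y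
∈++ˡ⁺ (x ∷ X) Y here = here
∈++ˡ⁺ (x ∷ X) Y (there h) = there (∈++ˡ⁺ X Y h)

∈++ˡ⁻ : ∀ {m n} {i : Fin m} (X : Subset m) (Y : Subset n) → i ↑ˡ n ∈ X ++ Y → i ∈ X
∈++ˡ⁻ {i = zero} (x ∷ X) Y here = here
∈++ˡ⁻ {i = suc i} (x ∷ X) Y (there h) = there (∈++ˡ⁻ X Y h)

∈++ʳ⁺ : ∀ {m n} {j : Fin n} (X : Subset m) (Y : Subset n) → j ∈ Y → m ↑ʳ j ∈ X ++ Y
∈++ʳ⁺ [] Y h = h
∈++ʳ⁺ (x ∷ X) Y h = there (∈++ʳ⁺ X Y h)

∈++ʳ⁻ : ∀ {m n} {j : Fin n} (X : Subset m) (Y : Subset n) → m ↑ʳ j ∈ X ++ Y → j ∈ Y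
∈++ʳ⁻ [] Y h = h
∈++ʳ⁻ (x ∷ X) Y (there h) = ∈++ʳ⁻ X Y h

↑ˡ≢↑ʳ : ∀ {m n} (i : Fin m) (j : Fin n) → i ↑ˡ n ≢ m ↑ʳ j
↑ˡ≢↑ʳ zero j ()
↑ˡ≢↑ʳ (suc i) j e = ↑ˡ≢↑ʳ i j (FinP.suc-injective e)

data SplitView (m n : ℕ) : Fin (m + n) → Set where
  inS : (i : Fin m) → SplitView m n (i ↑ˡ n)
  inT : (j : Fin n) → SplitView m n (m ↑ʳ j)

splitView : ∀ m n (x : Fin (m + n)) → SplitView m n x
splitView zero n x = inT x
splitView (suc m) n zero = inS zero
splitView (suc m) n (suc x) with splitView m n x
... | inS i = inS (suc i)
... | inT j = inT j

module Parts (m n : ℕ) where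

  split : (Z : Subset (m + n)) → Z ≡ take m Z ++ drop m Z
  split Z = sym (take++drop≡id m Z)

  ∣Z∣-split : (Z : Subset (m + n)) → ∣ Z ∣ ≡ ∣ take m Z ∣ + ∣ drop m Z ∣
  ∣Z∣-split Z = trans (cong ∣_∣ (split Z)) (∣X++Y∣ (take m Z) (drop m Z))

  take-∪ : (p q : Subset (m + n)) → take m (p ∪ q) ≡ take m p ∪ take m q
  take-∪ p q = take-zipWith _ p q
  drop-∪ : (p q : Subset (m + n)) → drop m (p ∪ q) ≡ drop m p ∪ drop m q
  drop-∪ p q = drop-zipWith _ p q
  take-∩ : (p q : Subset (m + n)) → take m (p ∩ q) ≡ take m p ∩ take m q
  take-∩ p q = take-zipWith _ p q
  drop-∩ : (p q : Subset (m + n)) → drop m (p ∩ q) ≡ drop m p ∩ drop m q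
  drop-∩ p q = drop-zipWith _ p q
  take-─ : (p q : Subset (m + n)) → take m (p ─ q) ≡ take m p ─ take m q
  take-─ p q = take-zipWith _ p q
  drop-─ : (p q : Subset (m + n)) → drop m (p ─ q) ≡ drop m p ─ drop m q
  drop-─ p q = drop-zipWith _ p q

  ∈take⁺ : ∀ {i : Fin m} (Z : Subset (m + n)) → i ↑ˡ n ∈ Z → i ∈ take m Z
  ∈take⁺ {i} Z h = ∈++ˡ⁻ (take m Z) (drop m Z) (subst (i ↑ˡ n ∈_) (split Z) h)
  ∈take⁻ : ∀ {i : Fin m} (Z : Subset (m + n)) → i ∈ take m Z → i ↑ˡ n ∈ Z
  ∈take⁻ {i} Z h = subst (i ↑ˡ n ∈_) (sym (split Z)) (∈++ˡ⁺ (take m Z) (drop m Z) h)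
  ∈drop⁺ : ∀ {j : Fin n} (Z : Subset (m + n)) → m ↑ʳ j ∈ Z → j ∈ drop m Z
  ∈drop⁺ {j} Z h = ∈++ʳ⁻ (take m Z) (drop m Z) (subst (m ↑ʳ j ∈_) (split Z) h)
  ∈drop⁻ : ∀ {j : Fin n} (Z : Subset (m + n)) → j ∈ drop m Z → m ↑ʳ j ∈ Z
  ∈drop⁻ {j} Z h = subst (m ↑ʳ j ∈_) (sym (split Z)) (∈++ʳ⁺ (take m Z) (drop m Z) h)

  take-mono : {p q : Subset (m + n)} → p ⊆ q → take m p ⊆ take m q
  take-mono {p} {q} h x = ∈take⁺ q (h (∈take⁻ p x))
  drop-mono : {p q : Subset (m + n)} → p ⊆ q → drop m p ⊆ drop m q
  drop-mono {p} {q} h x = ∈drop⁺ q (h (∈drop⁻ p x))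
  parts-⊆ : {p q : Subset (m + n)} → take m p ⊆ take m q → drop m p ⊆ drop m q → p ⊆ q
  parts-⊆ {p} {q} a b {x} h = subst (x ∈_) (sym (split q)) (++-mono a b (subst (x ∈_) (split p) h))

  take-⁅S⁆ : (i : Fin m) → take m ⁅ i ↑ˡ n ⁆ ≡ ⁅ i ⁆
  take-⁅S⁆ i = ⊆-antisym
    (λ {y} h → subst (_∈ ⁅ i ⁆) (sym (FinP.↑ˡ-injective n _ _ (x∈⁅y⁆⇒x≡y _ (∈take⁻ ⁅ i ↑ˡ n ⁆ h))))
                     (x∈⁅x⁆ i))
    (λ {y} h → subst (_∈ take m ⁅ i ↑ˡ n ⁆) (sym (x∈⁅y⁆⇒x≡y i h)) (∈take⁺ ⁅ i ↑ˡ n ⁆ (x∈⁅x⁆ _)))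

  drop-⁅S⁆ : (i : Fin m) → drop m ⁅ i ↑ˡ n ⁆ ≡ ⊥
  drop-⁅S⁆ i = Empty-unique λ { (y , h) → ↑ˡ≢↑ʳ i y (sym (x∈⁅y⁆⇒x≡y _ (∈drop⁻ ⁅ i ↑ˡ n ⁆ h))) }

  take-⁅T⁆ : (j : Fin n) → take m ⁅ m ↑ʳ j ⁆ ≡ ⊥
  take-⁅T⁆ j = Empty-unique λ { (y , h) → ↑ˡ≢↑ʳ y j (x∈⁅y⁆⇒x≡y _ (∈take⁻ ⁅ m ↑ʳ j ⁆ h)) }

  drop-⁅T⁆ : (j : Fin n) → drop m ⁅ m ↑ʳ j ⁆ ≡ ⁅ j ⁆
  drop-⁅T⁆ j = ⊆-antisym
    (λ {y} h → subst (_∈ ⁅ j ⁆) (sym (FinP.↑ʳ-injective m _ _ (x∈⁅y⁆⇒x≡y _ (∈drop⁻ ⁅ m ↑ʳ j ⁆ h))))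
                     (x∈⁅x⁆ j))
    (λ {y} h → subst (_∈ drop m ⁅ m ↑ʳ j ⁆) (sym (x∈⁅y⁆⇒x≡y j h)) (∈drop⁺ ⁅ m ↑ʳ j ⁆ (x∈⁅x⁆ _)))

  parts-del-S : (Z : Subset (m + n)) (i : Fin m) →
                take m (Z - (i ↑ˡ n)) ≡ take m Z - i × drop m (Z - (i ↑ˡ n)) ≡ drop m Z
  parts-del-S Z i = trans (take-─ Z _) (cong (take m Z ─_) (take-⁅S⁆ i))
                  , trans (drop-─ Z _) (trans (cong (drop m Z ─_) (drop-⁅S⁆ i)) (p─⊥≡p _))

  parts-del-T : (Z : Subset (m + n)) (j : Fin n) →
                take m (Z - (m ↑ʳ j)) ≡ take m Z × drop m (Z - (m ↑ʳ j)) ≡ drop m Z - j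
  parts-del-T Z j = trans (take-─ Z _) (trans (cong (take m Z ─_) (take-⁅T⁆ j)) (p─⊥≡p _))
                  , trans (drop-─ Z _) (cong (drop m Z ─_) (drop-⁅T⁆ j))

  parts-add-S : (Z : Subset (m + n)) (i : Fin m) →
                take m (Z ∪ ⁅ i ↑ˡ n ⁆) ≡ take m Z ∪ ⁅ i ⁆ × drop m (Z ∪ ⁅ i ↑ˡ n ⁆) ≡ drop m Z
  parts-add-S Z i = trans (take-∪ Z _) (cong (take m Z ∪_) (take-⁅S⁆ i))
                  , trans (drop-∪ Z _) (trans (cong (drop m Z ∪_) (drop-⁅S⁆ i)) (∪-identityʳ _))

  parts-add-T : (Z : Subset (m + n)) (j : Fin n) →
                take m (Z ∪ ⁅ m ↑ʳ j ⁆) ≡ take m Z × drop m (Z ∪ ⁅ m ↑ʳ j ⁆) ≡ drop m Z ∪ ⁅ j ⁆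
  parts-add-T Z j = trans (take-∪ Z _) (trans (cong (take m Z ∪_) (take-⁅T⁆ j)) (∪-identityʳ _))
                  , trans (drop-∪ Z _) (cong (drop m Z ∪_) (drop-⁅T⁆ j))

module Submodular {k : ℕ} (γ : Subset k → ℕ) (γ-mono : ∀ {X Y} → X ⊆ Y → γ X ≤ γ Y)
                  (γ-submodular : ∀ X Y → γ (X ∪ Y) + γ (X ∩ Y) ≤ γ X + γ Y) where

  diminishing : ∀ {X Y} W → X ⊆ Y → γ (Y ∪ W) + γ X ≤ γ Y + γ (X ∪ W)
  diminishing {X} {Y} W X⊆Y =
    ≤-trans (+-mono-≤ (γ-mono (∪-mono (λ h → h) (λ h → x∈p∪q⁺ (inj₂ h))))
                      (γ-mono (λ h → x∈p∩q⁺ (X⊆Y h , x∈p∪q⁺ (inj₁ h)))))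
            (γ-submodular Y (X ∪ W))

  subadditive : (∀ X → γ X ≤ ∣ X ∣) → ∀ X Y → γ (X ∪ Y) ≤ γ X + ∣ Y ∣
  subadditive γ≤∣∣ X Y = ≤-trans (m≤m+n _ _) (≤-trans (γ-submodular X Y) (+-monoʳ-≤ (γ X) (γ≤∣∣ Y)))

module RankFunction {k : ℕ} (Ind : Subset k → Set) (ρ : Subset k → ℕ)
                    (ρ-spec : ∀ X → IsRank Ind X (ρ X)) where

  rank-unique : ∀ {X j j'} → IsRank Ind X j → IsRank Ind X j' → j ≡ j'
  rank-unique ((I , I⊆X , indI , ∣I∣) , maxj) ((I' , I'⊆X , indI' , ∣I'∣) , maxj') =
    ≤-antisym (subst (_≤ _) ∣I∣ (maxj' I I⊆X indI)) (subst (_≤ _) ∣I'∣ (maxj I' I'⊆X indI'))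

  IsRank⇒≡ρ : ∀ {X j} → IsRank Ind X j → ρ X ≡ j
  IsRank⇒≡ρ {X} = rank-unique (ρ-spec X)

  ρ-mono : ∀ {X Y} → X ⊆ Y → ρ X ≤ ρ Y
  ρ-mono {X} {Y} X⊆Y with ρ-spec X
  ... | (I , I⊆X , indI , ∣I∣) , _ = subst (_≤ ρ Y) ∣I∣ (proj₂ (ρ-spec Y) I (λ h → X⊆Y (I⊆X h)) indI)

  ρ-cong : ∀ {X Y} → X ⊆ Y → Y ⊆ X → ρ X ≡ ρ Y
  ρ-cong X⊆Y Y⊆X = ≤-antisym (ρ-mono X⊆Y) (ρ-mono Y⊆X)

  ρ≤∣_∣ : ∀ X → ρ X ≤ ∣ X ∣
  ρ≤∣ X ∣ with ρ-spec X
  ... | (I , I⊆X , _ , ∣I∣) , _ = subst (_≤ ∣ X ∣) ∣I∣ (p⊆q⇒∣p∣≤∣q∣ I⊆X)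

  indep⇒∣∣≤ρ : ∀ {X} → Ind X → ∣ X ∣ ≤ ρ X
  indep⇒∣∣≤ρ {X} indX = proj₂ (ρ-spec X) X (λ h → h) indX

  indep⇒ρ≡∣∣ : ∀ {X} → Ind X → ρ X ≡ ∣ X ∣
  indep⇒ρ≡∣∣ indX = ≤-antisym (ρ≤∣ _ ∣) (indep⇒∣∣≤ρ indX)

  ∣∣≤ρ⇒indep : ∀ {X} → ∣ X ∣ ≤ ρ X → Ind X
  ∣∣≤ρ⇒indep {X} le with ρ-spec X
  ... | (I , I⊆X , indI , ∣I∣) , _ = subst Ind (∣p∣≥∣q∣⇒p≡q I⊆X (subst (∣ X ∣ ≤_) (sym ∣I∣) le)) indI

  decide-indep : ∀ X → Dec (Ind X)
  decide-indep X with ∣ X ∣ ≤? ρ X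
  ... | yes le = yes (∣∣≤ρ⇒indep le)
  ... | no nle = no λ indX → nle (indep⇒∣∣≤ρ indX)

  RankFlatIn : Subset k → Subset k → Set
  RankFlatIn E X = X ⊆ E × (∀ x → x ∈ E → x ∉ X → ρ X < ρ (X ∪ ⁅ x ⁆))

  flat⇒rankFlat : ∀ {E X} → FlatIn Ind E X → RankFlatIn E X
  flat⇒rankFlat {E} {X} (X⊆E , raises) =
    X⊆E , λ x x∈E x∉X → raises x x∈E x∉X _ _ (ρ-spec X) (ρ-spec _)

  rankFlat⇒flat : ∀ {E X} → RankFlatIn E X → FlatIn Ind E X
  rankFlat⇒flat (X⊆E , raises) = X⊆E , λ x x∈E x∉X j j' rj rj' →
    subst₂ _<_ (IsRank⇒≡ρ rj) (IsRank⇒≡ρ rj') (raises x x∈E x∉X)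

  RankCyclic : Subset k → Set
  RankCyclic X = ∀ e → e ∈ X → ρ (X - e) ≡ ρ X

  module Circuits (indep-⊆ : ∀ {I J} → J ⊆ I → Ind I → Ind J) where

    -- Every dependent set contains a circuit (by deleting elements while
    -- dependence persists; fuel bounds the number of deletions).
    circuit-within : ∀ (fuel : ℕ) D → ∣ D ∣ ≤ fuel → ¬ Ind D → ∃[ C ] (Circuit Ind C × C ⊆ D)
    circuit-within fuel D le depD with any? (λ y → (y ∈? D) ×-dec ¬? (decide-indep (D - y)))
    circuit-within zero D le depD | yes (y , y∈D , _) =
      ⊥-elim (<⇒≱ (x∈p⇒∣p-x∣<∣p∣ y∈D) (≤-trans le z≤n))
    circuit-within (suc fuel) D le depD | yes (y , y∈D , dep)
      with circuit-within fuel (D - y) (≤-pred (≤-trans (x∈p⇒∣p-x∣<∣p∣ y∈D) le)) dep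
    ... | C , circC , C⊆ = C , circC , λ h → p─q⊆p D ⁅ y ⁆ (C⊆ h)
    circuit-within fuel D le depD | no noneDep = D , (depD , minimal) , (λ h → h)
      where
      minimal : ∀ D' → D' ⊆ D → D' ≢ D → Ind D'
      minimal D' D'⊆D D'≢D with ⊈⇒witness D D' (λ D⊆D' → D'≢D (⊆-antisym D'⊆D D⊆D'))
      ... | y , y∈D , y∉D' =
        indep-⊆ (λ {z} z∈ → x∈p∧x≢y⇒x∈p-y (D'⊆D z∈) (λ { refl → y∉D' z∈ }))
                (decidable-stable (decide-indep (D - y)) (λ dep → noneDep (y , y∈D , dep)))

    -- If deleting e from Z keeps the rank, then e lies on a circuit inside Z:
    -- a basis I of Z - e spans e, so I ∪ {e} is dependent and its circuit uses e.
    circuit-through : ∀ {Z e} → e ∈ Z → ρ (Z - e) ≡ ρ Z → ∃[ C ] (Circuit Ind C × C ⊆ Z × e ∈ C)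
    circuit-through {Z} {e} e∈Z same with ρ-spec (Z - e)
    ... | (I , I⊆ , indI , ∣I∣) , _ with circuit-within _ (I ∪ ⁅ e ⁆) ≤-refl dependent
      where
      Ie⊆Z : I ∪ ⁅ e ⁆ ⊆ Z
      Ie⊆Z = ∪-lub (λ h → proj₁ (x∈p-y⁻ Z (I⊆ h))) (λ h → subst (_∈ Z) (sym (x∈⁅y⁆⇒x≡y e h)) e∈Z)
      dependent : ¬ Ind (I ∪ ⁅ e ⁆)
      dependent indIe = <⇒≱ (subst (ρ Z <_) (sym (∣p∪⁅x⁆∣ I (λ h → x∉p-x Z (I⊆ h))))
                               (s≤s (≤-reflexive (sym (trans ∣I∣ same)))))
                             (proj₂ (ρ-spec Z) (I ∪ ⁅ e ⁆) Ie⊆Z indIe)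
    ... | C , circC , C⊆ = C , circC , C⊆Z , e∈C
      where
      C⊆Z : C ⊆ Z
      C⊆Z h = [ (λ h' → proj₁ (x∈p-y⁻ Z (I⊆ h'))) , (λ h' → subst (_∈ Z) (sym (x∈⁅y⁆⇒x≡y e h')) e∈Z) ]′
                (x∈p∪q⁻ I ⁅ e ⁆ (C⊆ h))
      e∈C : e ∈ C
      e∈C = decidable-stable (e ∈? C) λ e∉C → proj₁ circC (indep-⊆ (C⊆I e∉C) indI)
        where
        C⊆I : e ∉ C → C ⊆ I
        C⊆I e∉C h = [ (λ h' → h') , (λ h' → ⊥-elim (e∉C (subst (_∈ C) (x∈⁅y⁆⇒x≡y e h') h))) ]′
                      (x∈p∪q⁻ I ⁅ e ⁆ (C⊆ h))

    circuit-rank : ∀ {C e} → Circuit Ind C → e ∈ C → ρ (C - e) ≡ ρ C × suc (ρ (C - e)) ≡ ∣ C ∣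
    circuit-rank {C} {e} (depC , minimal) e∈C = ≤-antisym (ρ-mono (p─q⊆p C ⁅ e ⁆)) ρC≤ , ∣C∣≡
      where
      ∣C∣≡ : suc (ρ (C - e)) ≡ ∣ C ∣
      ∣C∣≡ = trans (cong suc (indep⇒ρ≡∣∣ (minimal (C - e) (p─q⊆p C ⁅ e ⁆)
                                           (λ eq → x∉p-x C (subst (e ∈_) (sym eq) e∈C)))))
                   (∣p-x∣ C e∈C)
      ρC≤ : ρ C ≤ ρ (C - e)
      ρC≤ = ≤-pred (subst (ρ C <_) (sym ∣C∣≡)
              (≤∧≢⇒< (ρ≤∣ C ∣) (λ eq → depC (∣∣≤ρ⇒indep (≤-reflexive (sym eq))))))

    module ByRank (circuit-redundant : ∀ {C Z e} → Circuit Ind C → e ∈ C → C ⊆ Z → ρ (Z - e) ≡ ρ Z) where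

      cyclic⇒rankCyclic : ∀ {Z} → Cyclic Ind Z → RankCyclic Z
      cyclic⇒rankCyclic cycZ e e∈Z with cycZ e e∈Z
      ... | C , circC , C⊆Z , e∈C = circuit-redundant circC e∈C C⊆Z

      rankCyclic⇒cyclic : ∀ {Z} → RankCyclic Z → Cyclic Ind Z
      rankCyclic⇒cyclic red e e∈Z = circuit-through e∈Z (red e e∈Z)

      coloop⇒rank-drop : ∀ {F x} → ColoopIn Ind F x → ρ (F - x) < ρ F
      coloop⇒rank-drop {F} {x} (x∈F , onNoCircuit) = ≤∧≢⇒< (ρ-mono (p─q⊆p F ⁅ x ⁆)) λ eq →
        let C , circC , C⊆F , x∈C = circuit-through x∈F eq in onNoCircuit C circC C⊆F x∈C

      rank-drop⇒coloop : ∀ {F x} → x ∈ F → ρ (F - x) < ρ F → ColoopIn Ind F x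
      rank-drop⇒coloop x∈F lt = x∈F , λ C circC C⊆F x∈C → <-irrefl (circuit-redundant circC x∈C C⊆F) lt

module MatroidRank {k : ℕ} (M : Matroid k) where

  maximal⇒rank : ∀ {W Y} → W ⊆ Y → Indep M W →
    (∀ e → e ∈ Y → e ∉ W → ¬ Indep M (W ∪ ⁅ e ⁆)) → IsRank (Indep M) Y ∣ W ∣
  maximal⇒rank {W} W⊆Y indW maximal = (W , W⊆Y , indW , refl) , λ J J⊆Y indJ → ≮⇒≥ λ lt →
    let e , e∈J , e∉W , indWe = indep-aug M indW indJ lt in maximal e (J⊆Y e∈J) e∉W indWe

  -- Every independent I ⊆ Y extends to a maximal independent subset of Y
  -- (greedily; fuel bounds the number of added elements).
  extend : ∀ (fuel : ℕ) {I Y} → k ≤ ∣ I ∣ + fuel → Indep M I → I ⊆ Y →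
    ∃[ W ] (I ⊆ W × W ⊆ Y × Indep M W × IsRank (Indep M) Y ∣ W ∣)
  extend fuel {I} {Y} le indI I⊆Y
    with any? (λ e → (e ∈? Y) ×-dec (¬? (e ∈? I) ×-dec indep? M (I ∪ ⁅ e ⁆)))
  ... | no ne = I , (λ h → h) , I⊆Y , indI , maximal⇒rank I⊆Y indI (λ e e∈Y e∉I indIe → ne (e , e∈Y , e∉I , indIe))
  extend zero {I} le indI I⊆Y | yes (e , e∈Y , e∉I , indIe) =
    ⊥-elim (<⇒≱ (subst (_≤ k) (∣p∪⁅x⁆∣ I e∉I) (∣p∣≤n (I ∪ ⁅ e ⁆))) (subst (k ≤_) (+-identityʳ _) le))
  extend (suc fuel) {I} {Y} le indI I⊆Y | yes (e , e∈Y , e∉I , indIe)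
    with extend fuel {I ∪ ⁅ e ⁆} {Y}
           (subst (k ≤_) (trans (+-suc _ _) (cong (_+ fuel) (sym (∣p∪⁅x⁆∣ I e∉I)))) le) indIe
           (∪-lub I⊆Y (λ h → subst (_∈ Y) (sym (x∈⁅y⁆⇒x≡y e h)) e∈Y))
  ... | W , IeW , W⊆Y , indW , rankW = W , (λ h → IeW (x∈p∪q⁺ (inj₁ h))) , W⊆Y , indW , rankW

  rk : Subset k → ℕ
  rk X = ∣ proj₁ (extend k (m≤n+m k ∣ ⊥ {k} ∣) (indep-∅ M) (⊆-min X)) ∣

  rk-spec : ∀ X → IsRank (Indep M) X (rk X)
  rk-spec X = proj₂ (proj₂ (proj₂ (proj₂ (extend k (m≤n+m k ∣ ⊥ {k} ∣) (indep-∅ M) (⊆-min X)))))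

  open RankFunction (Indep M) rk rk-spec public

  -- Submodularity: extend a basis of X ∩ Y to one of X ∪ Y and split it.
  submodular : ∀ X Y → rk (X ∪ Y) + rk (X ∩ Y) ≤ rk X + rk Y
  submodular X Y with rk-spec (X ∩ Y)
  ... | (I , I⊆ , indI , ∣I∣) , _
    with extend k {I} {X ∪ Y} (m≤n+m k _) indI (λ h → p⊆p∪q Y (p∩q⊆p X Y (I⊆ h)))
  ... | K , I⊆K , K⊆ , indK , rankK = begin
      rk (X ∪ Y) + rk (X ∩ Y)                   ≡⟨ cong₂ _+_ (IsRank⇒≡ρ rankK) (sym ∣I∣) ⟩
      ∣ K ∣ + ∣ I ∣                              ≤⟨ +-mono-≤ (p⊆q⇒∣p∣≤∣q∣ K-split) (p⊆q⇒∣p∣≤∣q∣ I-split) ⟩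
      ∣ K ∩ X ∪ K ∩ Y ∣ + ∣ (K ∩ X) ∩ (K ∩ Y) ∣ ≡⟨ ∣p∪q∣+∣p∩q∣ (K ∩ X) (K ∩ Y) ⟩
      ∣ K ∩ X ∣ + ∣ K ∩ Y ∣                     ≤⟨ +-mono-≤ (part X) (part Y) ⟩
      rk X + rk Y ∎
    where
    open ≤-Reasoning
    K-split : K ⊆ K ∩ X ∪ K ∩ Y
    K-split h with x∈p∪q⁻ X Y (K⊆ h)
    ... | inj₁ h' = x∈p∪q⁺ (inj₁ (x∈p∩q⁺ (h , h')))
    ... | inj₂ h' = x∈p∪q⁺ (inj₂ (x∈p∩q⁺ (h , h')))
    I-split : I ⊆ (K ∩ X) ∩ (K ∩ Y)
    I-split h = let hx , hy = x∈p∩q⁻ X Y (I⊆ h) in x∈p∩q⁺ (x∈p∩q⁺ (I⊆K h , hx) , x∈p∩q⁺ (I⊆K h , hy))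
    part : ∀ W → ∣ K ∩ W ∣ ≤ rk W
    part W = proj₂ (rk-spec W) _ (p∩q⊆q K W) (indep-⊆ M (p∩q⊆p K W) indK)

  open Submodular rk ρ-mono submodular public using (diminishing)

  subadditive : ∀ X Y → rk (X ∪ Y) ≤ rk X + ∣ Y ∣
  subadditive = Submodular.subadditive rk ρ-mono submodular ρ≤∣_∣

  rk-∪⁅e⁆ : ∀ X e → rk (X ∪ ⁅ e ⁆) ≤ suc (rk X)
  rk-∪⁅e⁆ X e = ≤-trans (subadditive X ⁅ e ⁆) (≤-reflexive (trans (cong (rk X +_) (∣⁅x⁆∣≡1 e)) (+-comm _ 1)))

  rk-─⁅e⁆ : ∀ X e → rk X ≤ suc (rk (X - e))
  rk-─⁅e⁆ X e = ≤-trans (ρ-mono (⊆-del-add X e)) (rk-∪⁅e⁆ (X - e) e)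

  open Circuits (indep-⊆ M) public

  -- An element of a circuit C ⊆ Z is redundant in Z (submodularity on Z - e and C).
  circuit-redundant : ∀ {C Z e} → Circuit (Indep M) C → e ∈ C → C ⊆ Z → rk (Z - e) ≡ rk Z
  circuit-redundant {C} {Z} {e} circC e∈C C⊆Z = ≤-antisym (ρ-mono (p─q⊆p Z ⁅ e ⁆)) (+-cancelʳ-≤ (rk (C - e)) _ _ (begin
      rk Z + rk (C - e)                   ≤⟨ +-mono-≤ (ρ-mono Z⊆) (ρ-mono C-e⊆) ⟩
      rk ((Z - e) ∪ C) + rk ((Z - e) ∩ C) ≤⟨ submodular (Z - e) C ⟩
      rk (Z - e) + rk C                   ≡⟨ cong (rk (Z - e) +_) (sym (proj₁ (circuit-rank circC e∈C))) ⟩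
      rk (Z - e) + rk (C - e) ∎))
    where
    open ≤-Reasoning
    Z⊆ : Z ⊆ (Z - e) ∪ C
    Z⊆ = ⊆-trans (⊆-del-add Z e) (∪-mono (λ h → h) (λ h → subst (_∈ C) (sym (x∈⁅y⁆⇒x≡y e h)) e∈C))
    C-e⊆ : C - e ⊆ (Z - e) ∩ C
    C-e⊆ h = let h₁ , h₂ = x∈p-y⁻ C h in x∈p∩q⁺ (x∈p∧x≢y⇒x∈p-y (C⊆Z h₁) h₂ , h₁)

  open ByRank circuit-redundant public

module PrincipalSumRank {m n : ℕ} (M : Matroid m) (N : Matroid n) (A : Subset m) (B : Subset n) where
  open Parts m n
  module MR = MatroidRank M
  module NR = MatroidRank N
  r : Subset m → ℕ
  r = MR.rk
  q : Subset n → ℕ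
  q = NR.rk

  -- r_P(F ∪ G) = min(αₚ F G, βₚ F G) for F ⊆ S, G ⊆ T: the two ways of
  -- spending G ∩ B (as free elements of M⁺, or inside N).
  αₚ : Subset m → Subset n → ℕ
  αₚ F G = r F + q (G ∩ ∁ B) + ∣ G ∩ B ∣

  βₚ : Subset m → Subset n → ℕ
  βₚ F G = r (F ∪ A) + q G

  ρₚ : Subset m → Subset n → ℕ
  ρₚ F G = αₚ F G ⊓ βₚ F G

  α β ρP : Subset (m + n) → ℕ
  α Z = αₚ (take m Z) (drop m Z)
  β Z = βₚ (take m Z) (drop m Z)
  ρP Z = ρₚ (take m Z) (drop m Z)

  IP : Subset (m + n) → Set
  IP = IndepP M N A B

  M⁺-intro : ∀ (X : Subset m) (Y : Subset n) → ∣ X ∣ + ∣ Y ∣ ≤ r (X ∪ A) →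
    ∣ X ∣ + ∣ Y ∣ ≤ r X + ∣ Y ∩ B ∣ → IndepM⁺ M N A B (X ++ Y)
  M⁺-intro X Y p₁ p₂ j₁ j₂ r₁ r₂ rewrite take-++ X Y | drop-++ X Y =
    subst (∣ X ∣ + ∣ Y ∣ ≤_) (MR.IsRank⇒≡ρ r₁) p₁ ,
    subst (λ j → ∣ X ∣ + ∣ Y ∣ ≤ j + ∣ Y ∩ B ∣) (MR.IsRank⇒≡ρ r₂) p₂

  M⁺-elim : ∀ {I} → IndepM⁺ M N A B I →
    ∣ take m I ∣ + ∣ drop m I ∣ ≤ r (take m I ∪ A) × ∣ take m I ∣ + ∣ drop m I ∣ ≤ r (take m I) + ∣ drop m I ∩ B ∣
  M⁺-elim indI = indI _ _ (MR.rk-spec _) (MR.rk-spec _)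

  -- In an independent set of M⁺(A,B) the S-part is independent in M and the
  -- T-part lies in B (the elements of T - B are loops).
  M⁺-parts : ∀ (X : Subset m) (Y : Subset n) → ∣ X ∣ + ∣ Y ∣ ≤ r X + ∣ Y ∩ B ∣ →
             ∣ X ∣ ≤ r X × ∣ Y ∩ ∁ B ∣ ≤ 0
  M⁺-parts X Y le =
    +-cancelʳ-≤ ∣ Y ∣ _ _ (≤-trans le (+-monoʳ-≤ (r X) (∣p∩q∣≤∣p∣ Y B))) ,
    +-cancelˡ-≤ (∣ X ∣ + ∣ Y ∩ B ∣) _ _ (begin
      ∣ X ∣ + ∣ Y ∩ B ∣ + ∣ Y ∩ ∁ B ∣   ≡⟨ +-assoc ∣ X ∣ _ _ ⟩
      ∣ X ∣ + (∣ Y ∩ B ∣ + ∣ Y ∩ ∁ B ∣) ≡⟨ cong (∣ X ∣ +_) (sym (∣p∣-split Y B)) ⟩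
      ∣ X ∣ + ∣ Y ∣                       ≤⟨ le ⟩
      r X + ∣ Y ∩ B ∣                     ≤⟨ +-monoˡ-≤ _ (MR.ρ≤∣ X ∣) ⟩
      ∣ X ∣ + ∣ Y ∩ B ∣                   ≡⟨ sym (+-identityʳ _) ⟩
      ∣ X ∣ + ∣ Y ∩ B ∣ + 0 ∎)
    where open ≤-Reasoning

  T-part-bound : ∀ {G Y₁ Y₂ : Subset n} → Y₁ ⊆ G → Y₂ ⊆ G → ∣ Y₁ ∩ ∁ B ∣ ≤ 0 → Indep N Y₂ →
                 ∣ Y₁ ∪ Y₂ ∣ ≤ q (G ∩ ∁ B) + ∣ G ∩ B ∣
  T-part-bound {G} {Y₁} {Y₂} Y₁⊆G Y₂⊆G Y₁⊆B indY₂ = begin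
    ∣ Y₁ ∪ Y₂ ∣                                 ≡⟨ ∣p∣-split (Y₁ ∪ Y₂) B ⟩
    ∣ (Y₁ ∪ Y₂) ∩ B ∣ + ∣ (Y₁ ∪ Y₂) ∩ ∁ B ∣     ≤⟨ +-mono-≤ (p⊆q⇒∣p∣≤∣q∣ (∩-mono (∪-lub Y₁⊆G Y₂⊆G) (λ h → h)))
                                                            (p⊆q⇒∣p∣≤∣q∣ (⊆-reflexive (∩-distribʳ-∪ (∁ B) Y₁ Y₂))) ⟩
    ∣ G ∩ B ∣ + ∣ Y₁ ∩ ∁ B ∪ Y₂ ∩ ∁ B ∣         ≤⟨ +-monoʳ-≤ ∣ G ∩ B ∣ (∣p∪q∣≤∣p∣+∣q∣ (Y₁ ∩ ∁ B) (Y₂ ∩ ∁ B)) ⟩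
    ∣ G ∩ B ∣ + (∣ Y₁ ∩ ∁ B ∣ + ∣ Y₂ ∩ ∁ B ∣)   ≤⟨ +-monoʳ-≤ ∣ G ∩ B ∣ (+-mono-≤ Y₁⊆B Y₂-bound) ⟩
    ∣ G ∩ B ∣ + (0 + q (G ∩ ∁ B))               ≡⟨ +-comm ∣ G ∩ B ∣ _ ⟩
    q (G ∩ ∁ B) + ∣ G ∩ B ∣ ∎
    where
    open ≤-Reasoning
    Y₂-bound : ∣ Y₂ ∩ ∁ B ∣ ≤ q (G ∩ ∁ B)
    Y₂-bound = proj₂ (NR.rk-spec (G ∩ ∁ B)) (Y₂ ∩ ∁ B) (∩-mono Y₂⊆G (λ h → h))
                 (indep-⊆ N (p∩q⊆p Y₂ (∁ B)) indY₂)

  IP-bound : ∀ Z I → I ⊆ Z → IP I → ∣ I ∣ ≤ ρP Z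
  IP-bound Z .(I₁ ∪ I₂) I⊆Z (I₁ , I₂ , indI₁ , (I₂∩S≡⊥ , indY₂) , refl) = ⊓-glb ≤α ≤β
    where
    open ≤-Reasoning
    F = take m Z
    G = drop m Z
    X₁ = take m I₁
    Y₁ = drop m I₁
    Y₂ = drop m I₂
    ≤r[X₁∪A] : ∣ X₁ ∣ + ∣ Y₁ ∣ ≤ r (X₁ ∪ A)
    ≤r[X₁∪A] = proj₁ (M⁺-elim indI₁)
    ∣X₁∣≤rX₁ : ∣ X₁ ∣ ≤ r X₁
    ∣X₁∣≤rX₁ = proj₁ (M⁺-parts X₁ Y₁ (proj₂ (M⁺-elim indI₁)))
    Y₁⊆B : ∣ Y₁ ∩ ∁ B ∣ ≤ 0
    Y₁⊆B = proj₂ (M⁺-parts X₁ Y₁ (proj₂ (M⁺-elim indI₁)))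
    ∣I∣≡ : ∣ I₁ ∪ I₂ ∣ ≡ ∣ X₁ ∣ + ∣ Y₁ ∪ Y₂ ∣
    ∣I∣≡ = trans (∣Z∣-split (I₁ ∪ I₂)) (cong₂ _+_
      (cong ∣_∣ (trans (take-∪ I₁ I₂) (trans (cong (X₁ ∪_) I₂∩S≡⊥) (∪-identityʳ X₁))))
      (cong ∣_∣ (drop-∪ I₁ I₂)))
    X₁⊆F : X₁ ⊆ F
    X₁⊆F = take-mono (λ h → I⊆Z (x∈p∪q⁺ (inj₁ h)))
    Y₁⊆G : Y₁ ⊆ G
    Y₁⊆G = drop-mono (λ h → I⊆Z (x∈p∪q⁺ (inj₁ h)))
    Y₂⊆G : Y₂ ⊆ G
    Y₂⊆G = drop-mono (λ {x} h → I⊆Z (x∈p∪q⁺ {p = I₁} (inj₂ h)))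
    ≤α : ∣ I₁ ∪ I₂ ∣ ≤ α Z
    ≤α = begin
      ∣ I₁ ∪ I₂ ∣                     ≡⟨ ∣I∣≡ ⟩
      ∣ X₁ ∣ + ∣ Y₁ ∪ Y₂ ∣             ≤⟨ +-mono-≤ (≤-trans ∣X₁∣≤rX₁ (MR.ρ-mono X₁⊆F)) (T-part-bound Y₁⊆G Y₂⊆G Y₁⊆B indY₂) ⟩
      r F + (q (G ∩ ∁ B) + ∣ G ∩ B ∣) ≡⟨ sym (+-assoc (r F) _ _) ⟩
      α Z ∎
    ≤β : ∣ I₁ ∪ I₂ ∣ ≤ β Z
    ≤β = begin
      ∣ I₁ ∪ I₂ ∣                ≡⟨ ∣I∣≡ ⟩
      ∣ X₁ ∣ + ∣ Y₁ ∪ Y₂ ∣        ≤⟨ +-monoʳ-≤ ∣ X₁ ∣ (∣p∪q∣≤∣p∣+∣q∣ Y₁ Y₂) ⟩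
      ∣ X₁ ∣ + (∣ Y₁ ∣ + ∣ Y₂ ∣)   ≡⟨ sym (+-assoc ∣ X₁ ∣ _ _) ⟩
      ∣ X₁ ∣ + ∣ Y₁ ∣ + ∣ Y₂ ∣     ≤⟨ +-mono-≤ (≤-trans ≤r[X₁∪A] (MR.ρ-mono (∪-mono X₁⊆F (λ h → h))))
                                            (proj₂ (NR.rk-spec G) Y₂ Y₂⊆G indY₂) ⟩
      r (F ∪ A) + q G ∎

  B-adapted-basis : ∀ G → ∃[ J ] (J ⊆ G × Indep N J × ∣ J ∣ ≡ q G × ∣ J ∩ ∁ B ∣ ≡ q (G ∩ ∁ B))
  B-adapted-basis G with proj₁ (NR.rk-spec (G ∩ ∁ B))
  ... | J₀ , J₀⊆ , indJ₀ , ∣J₀∣ with NR.extend n (m≤n+m n _) indJ₀ (λ h → p∩q⊆p G (∁ B) (J₀⊆ h))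
  ... | J , J₀⊆J , J⊆G , indJ , rankJ =
    J , J⊆G , indJ , sym (NR.IsRank⇒≡ρ rankJ) ,
    ≤-antisym (proj₂ (NR.rk-spec (G ∩ ∁ B)) (J ∩ ∁ B) (∩-mono J⊆G (λ h → h)) (indep-⊆ N (p∩q⊆p J (∁ B)) indJ))
              (subst (_≤ ∣ J ∩ ∁ B ∣) ∣J₀∣ (p⊆q⇒∣p∣≤∣q∣ (λ h → x∈p∩q⁺ (J₀⊆J h , proj₂ (x∈p∩q⁻ G (∁ B) (J₀⊆ h))))))

  α-via-basis : ∀ F G J → J ⊆ G → ∣ J ∣ ≡ q G → ∣ J ∩ ∁ B ∣ ≡ q (G ∩ ∁ B) →
                αₚ F G ≡ (r F + q G) + ∣ (G ∩ B) ∩ ∁ J ∣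
  α-via-basis F G J J⊆G ∣J∣ ∣J-B∣ = begin
    r F + q (G ∩ ∁ B) + ∣ G ∩ B ∣                ≡⟨ cong (r F + q (G ∩ ∁ B) +_) (∣p∣-split (G ∩ B) J) ⟩
    r F + q (G ∩ ∁ B) + (∣ (G ∩ B) ∩ J ∣ + ∣ U ∣) ≡⟨ cong (λ c → r F + q (G ∩ ∁ B) + (c + ∣ U ∣)) ∣GB∩J∣ ⟩
    r F + q (G ∩ ∁ B) + (∣ J ∩ B ∣ + ∣ U ∣)       ≡⟨ sym (+-assoc (r F + q (G ∩ ∁ B)) _ _) ⟩
    r F + q (G ∩ ∁ B) + ∣ J ∩ B ∣ + ∣ U ∣         ≡⟨ cong (_+ ∣ U ∣) (trans (+-assoc (r F) _ _)
                                                       (cong (r F +_) (+-comm (q (G ∩ ∁ B)) _))) ⟩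
    r F + (∣ J ∩ B ∣ + q (G ∩ ∁ B)) + ∣ U ∣       ≡⟨ cong (λ c → r F + c + ∣ U ∣) (sym qG≡) ⟩
    r F + q G + ∣ U ∣ ∎
    where
    open ≡-Reasoning
    U = (G ∩ B) ∩ ∁ J
    qG≡ : q G ≡ ∣ J ∩ B ∣ + q (G ∩ ∁ B)
    qG≡ = trans (sym ∣J∣) (trans (∣p∣-split J B) (cong (∣ J ∩ B ∣ +_) ∣J-B∣))
    ∣GB∩J∣ : ∣ (G ∩ B) ∩ J ∣ ≡ ∣ J ∩ B ∣
    ∣GB∩J∣ = ∣-∣-cong (λ h → let a , b = x∈p∩q⁻ (G ∩ B) J h in x∈p∩q⁺ (b , proj₂ (x∈p∩q⁻ G B a)))
                      (λ h → let a , b = x∈p∩q⁻ J B h in x∈p∩q⁺ (x∈p∩q⁺ (J⊆G a , b) , a))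

  -- Lower bound: Z contains an independent set of P of size min(α,β)(Z), namely
  -- a basis X of F, a B-adapted basis J of G, and min(|U|, r(F ∪ A) - r F)
  -- further elements Y₁ of U = (G ∩ B) - J added freely to M.
  IP-realised : ∀ Z → ∃[ I ] (I ⊆ Z × IP I × ∣ I ∣ ≡ ρP Z)
  IP-realised Z with proj₁ (MR.rk-spec (take m Z)) | B-adapted-basis (drop m Z)
  ... | X , X⊆F , indX , ∣X∣ | J , J⊆G , indJ , ∣J∣ , ∣J-B∣
    with ⊆-of-size ((drop m Z ∩ B) ∩ ∁ J)
           (∣ (drop m Z ∩ B) ∩ ∁ J ∣ ⊓ (r (take m Z ∪ A) ∸ r (take m Z))) (m⊓n≤m _ _)
  ... | Y₁ , Y₁⊆U , ∣Y₁∣ = I₁ ∪ I₂ , I⊆Z , (I₁ , I₂ , indI₁ , indI₂ , refl) , ∣I∣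
    where
    I₁ I₂ : Subset (m + n)
    I₁ = X ++ Y₁
    I₂ = ⊥ ++ J
    indI₂ : IndepN₀ M N A B I₂
    indI₂ = take-++ (⊥ {m}) J , subst (Indep N) (sym (drop-++ (⊥ {m}) J)) indJ
    F = take m Z
    G = drop m Z
    U = (G ∩ B) ∩ ∁ J
    d = r (F ∪ A) ∸ r F
    rF≤ : r F ≤ r (F ∪ A)
    rF≤ = MR.ρ-mono (p⊆p∪q A)
    Y₁⊆G : Y₁ ⊆ G
    Y₁⊆G h = proj₁ (x∈p∩q⁻ G B (proj₁ (x∈p∩q⁻ (G ∩ B) (∁ J) (Y₁⊆U h))))
    Y₁⊆B : Y₁ ⊆ B
    Y₁⊆B h = proj₂ (x∈p∩q⁻ G B (proj₁ (x∈p∩q⁻ (G ∩ B) (∁ J) (Y₁⊆U h))))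
    span : r (F ∪ A) ≤ r (X ∪ A)
    span = +-cancelʳ-≤ (r F) _ _ (begin
      r (F ∪ A) + r F   ≡⟨ cong (r (F ∪ A) +_) (sym (trans (MR.indep⇒ρ≡∣∣ indX) ∣X∣)) ⟩
      r (F ∪ A) + r X   ≤⟨ MR.diminishing A X⊆F ⟩
      r F + r (X ∪ A)   ≡⟨ +-comm (r F) _ ⟩
      r (X ∪ A) + r F ∎)
      where open ≤-Reasoning
    indI₁ : IndepM⁺ M N A B I₁
    indI₁ = M⁺-intro X Y₁
      (begin
        ∣ X ∣ + ∣ Y₁ ∣     ≡⟨ cong₂ _+_ ∣X∣ ∣Y₁∣ ⟩
        r F + (∣ U ∣ ⊓ d)  ≤⟨ +-monoʳ-≤ (r F) (m⊓n≤n _ _) ⟩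
        r F + d           ≡⟨ m+[n∸m]≡n rF≤ ⟩
        r (F ∪ A)         ≤⟨ span ⟩
        r (X ∪ A) ∎)
      (≤-reflexive (cong₂ _+_ (sym (MR.indep⇒ρ≡∣∣ indX)) (∣-∣-cong (λ h → x∈p∩q⁺ (h , Y₁⊆B h)) (p∩q⊆p Y₁ B))))
      where open ≤-Reasoning
    take-I : take m (I₁ ∪ I₂) ≡ X
    take-I = trans (take-∪ I₁ I₂) (trans (cong₂ _∪_ (take-++ X Y₁) (take-++ (⊥ {m}) J)) (∪-identityʳ X))
    drop-I : drop m (I₁ ∪ I₂) ≡ Y₁ ∪ J
    drop-I = trans (drop-∪ I₁ I₂) (cong₂ _∪_ (drop-++ X Y₁) (drop-++ (⊥ {m}) J))
    I⊆Z : I₁ ∪ I₂ ⊆ Z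
    I⊆Z = parts-⊆ (λ h → X⊆F (subst (_ ∈_) take-I h))
                  (λ {x} h → ∪-lub Y₁⊆G J⊆G (subst (x ∈_) drop-I h))
    Y₁∩J≡∅ : ∀ y → y ∈ Y₁ → y ∉ J
    Y₁∩J≡∅ y h = x∈∁p⇒x∉p (proj₂ (x∈p∩q⁻ (G ∩ B) (∁ J) (Y₁⊆U h)))
    ∣I∣ : ∣ I₁ ∪ I₂ ∣ ≡ ρP Z
    ∣I∣ = begin
      ∣ I₁ ∪ I₂ ∣               ≡⟨ ∣Z∣-split _ ⟩
      ∣ take m _ ∣ + ∣ drop m _ ∣          ≡⟨ cong₂ _+_ (cong ∣_∣ take-I) (cong ∣_∣ drop-I) ⟩
      ∣ X ∣ + ∣ Y₁ ∪ J ∣                   ≡⟨ cong₂ _+_ ∣X∣ (trans (∣p∪q∣≡∣p∣+∣q∣ Y₁ J Y₁∩J≡∅) (cong₂ _+_ ∣Y₁∣ (∣J∣))) ⟩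
      r F + ((∣ U ∣ ⊓ d) + q G)            ≡⟨ cong (r F +_) (+-comm (∣ U ∣ ⊓ d) (q G)) ⟩
      r F + (q G + (∣ U ∣ ⊓ d))            ≡⟨ sym (+-assoc (r F) (q G) _) ⟩
      (r F + q G) + (∣ U ∣ ⊓ d)            ≡⟨ +-distribˡ-⊓ (r F + q G) ∣ U ∣ d ⟩
      (r F + q G + ∣ U ∣) ⊓ (r F + q G + d) ≡⟨ cong₂ _⊓_ (sym (α-via-basis F G J J⊆G ∣J∣ ∣J-B∣)) β≡ ⟩
      ρP Z ∎
      where
      open ≡-Reasoning
      β≡ : r F + q G + d ≡ β Z
      β≡ = trans (trans (+-assoc (r F) (q G) d) (trans (cong (r F +_) (+-comm (q G) d)) (sym (+-assoc (r F) d (q G)))))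
                 (cong (_+ q G) (m+[n∸m]≡n rF≤))

  ρP-spec : ∀ Z → IsRank IP Z (ρP Z)
  ρP-spec Z = IP-realised Z , IP-bound Z

module PrincipalSumMatroid {m n : ℕ} (M : Matroid m) (N : Matroid n) (A : Subset m) (B : Subset n) where
  open Parts m n
  open PrincipalSumRank M N A B

  αₚ-mono : ∀ {F F' G G'} → F ⊆ F' → G ⊆ G' → αₚ F G ≤ αₚ F' G'
  αₚ-mono F⊆F' G⊆G' = +-mono-≤ (+-mono-≤ (MR.ρ-mono F⊆F') (NR.ρ-mono (∩-mono G⊆G' (λ h → h))))
                                (p⊆q⇒∣p∣≤∣q∣ (∩-mono G⊆G' (λ h → h)))

  βₚ-mono : ∀ {F F' G G'} → F ⊆ F' → G ⊆ G' → βₚ F G ≤ βₚ F' G'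
  βₚ-mono F⊆F' G⊆G' = +-mono-≤ (MR.ρ-mono (∪-mono F⊆F' (λ h → h))) (NR.ρ-mono G⊆G')

  ρₚ-mono : ∀ {F F' G G'} → F ⊆ F' → G ⊆ G' → ρₚ F G ≤ ρₚ F' G'
  ρₚ-mono F⊆F' G⊆G' = ⊓-mono-≤ (αₚ-mono F⊆F' G⊆G') (βₚ-mono F⊆F' G⊆G')

  α-mono : ∀ {Z W} → Z ⊆ W → α Z ≤ α W
  α-mono Z⊆W = αₚ-mono (take-mono Z⊆W) (drop-mono Z⊆W)

  β-mono : ∀ {Z W} → Z ⊆ W → β Z ≤ β W
  β-mono Z⊆W = βₚ-mono (take-mono Z⊆W) (drop-mono Z⊆W)

  αₚ-submodular : ∀ F F' G G' → αₚ (F ∪ F') (G ∪ G') + αₚ (F ∩ F') (G ∩ G') ≤ αₚ F G + αₚ F' G'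
  αₚ-submodular F F' G G' = +-mono-≤₂ {r (F ∪ F') + _} {r (F ∩ F') + _} {r F + _} {r F' + _}
    (+-mono-≤₂ {r (F ∪ F')} {r (F ∩ F')} {r F} {r F'} (MR.submodular F F')
      (≤-trans (+-mono-≤ (NR.ρ-mono (⊆-reflexive (∩-distribʳ-∪ (∁ B) G G')))
                         (NR.ρ-mono (∩-distribʳ-∩ G G' (∁ B))))
               (NR.submodular (G ∩ ∁ B) (G' ∩ ∁ B))))
    (≤-trans (+-mono-≤ (p⊆q⇒∣p∣≤∣q∣ (⊆-reflexive (∩-distribʳ-∪ B G G')))
                       (p⊆q⇒∣p∣≤∣q∣ (∩-distribʳ-∩ G G' B)))
             (≤-reflexive (∣p∪q∣+∣p∩q∣ (G ∩ B) (G' ∩ B))))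

  βₚ-submodular : ∀ F F' G G' → βₚ (F ∪ F') (G ∪ G') + βₚ (F ∩ F') (G ∩ G') ≤ βₚ F G + βₚ F' G'
  βₚ-submodular F F' G G' = +-mono-≤₂ {r ((F ∪ F') ∪ A)} {r ((F ∩ F') ∪ A)} {r (F ∪ A)} {r (F' ∪ A)}
    (≤-trans (+-mono-≤ (MR.ρ-mono (∪-lub (∪-mono (p⊆p∪q A) (p⊆p∪q A)) (λ h → x∈p∪q⁺ (inj₁ (x∈p∪q⁺ (inj₂ h))))))
                       (MR.ρ-mono (⊆-reflexive (∪-distribʳ-∩ A F F'))))
             (MR.submodular (F ∪ A) (F' ∪ A)))
    (NR.submodular G G')

  α-submodular : ∀ Z W → α (Z ∪ W) + α (Z ∩ W) ≤ α Z + α W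
  α-submodular Z W rewrite take-∪ Z W | drop-∪ Z W | take-∩ Z W | drop-∩ Z W =
    αₚ-submodular (take m Z) (take m W) (drop m Z) (drop m W)

  β-submodular : ∀ Z W → β (Z ∪ W) + β (Z ∩ W) ≤ β Z + β W
  β-submodular Z W rewrite take-∪ Z W | drop-∪ Z W | take-∩ Z W | drop-∩ Z W =
    βₚ-submodular (take m Z) (take m W) (drop m Z) (drop m W)

  module Sα = Submodular α α-mono α-submodular
  module Sβ = Submodular β β-mono β-submodular

  α≤∣_∣ : ∀ Z → α Z ≤ ∣ Z ∣
  α≤∣ Z ∣ = begin
    r F + q (G ∩ ∁ B) + ∣ G ∩ B ∣      ≤⟨ +-monoˡ-≤ _ (+-mono-≤ (MR.ρ≤∣ F ∣) (NR.ρ≤∣ G ∩ ∁ B ∣)) ⟩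
    ∣ F ∣ + ∣ G ∩ ∁ B ∣ + ∣ G ∩ B ∣     ≡⟨ +-assoc ∣ F ∣ _ _ ⟩
    ∣ F ∣ + (∣ G ∩ ∁ B ∣ + ∣ G ∩ B ∣)   ≡⟨ cong (∣ F ∣ +_) (trans (+-comm ∣ G ∩ ∁ B ∣ _) (sym (∣p∣-split G B))) ⟩
    ∣ F ∣ + ∣ G ∣                      ≡⟨ sym (∣Z∣-split Z) ⟩
    ∣ Z ∣ ∎
    where
    open ≤-Reasoning
    F = take m Z
    G = drop m Z

  β-subadditive : ∀ Z W → β (Z ∪ W) ≤ β Z + ∣ W ∣
  β-subadditive Z W = begin
    β (Z ∪ W)                              ≡⟨ cong₂ βₚ (take-∪ Z W) (drop-∪ Z W) ⟩
    r ((F ∪ F') ∪ A) + q (G ∪ G')          ≤⟨ +-mono-≤ (≤-trans (MR.ρ-mono F∪F'∪A⊆) (MR.subadditive (F ∪ A) F'))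
                                                       (NR.subadditive G G') ⟩
    (r (F ∪ A) + ∣ F' ∣) + (q G + ∣ G' ∣)  ≡⟨ interchange (r (F ∪ A)) (∣ F' ∣) (q G) (∣ G' ∣) ⟩
    β Z + (∣ F' ∣ + ∣ G' ∣)                ≡⟨ cong (β Z +_) (sym (∣Z∣-split W)) ⟩
    β Z + ∣ W ∣ ∎
    where
    open ≤-Reasoning
    F = take m Z
    G = drop m Z
    F' = take m W
    G' = drop m W
    F∪F'∪A⊆ : (F ∪ F') ∪ A ⊆ (F ∪ A) ∪ F'
    F∪F'∪A⊆ = ∪-lub (∪-mono (p⊆p∪q A) (λ h → h)) (λ h → x∈p∪q⁺ (inj₁ (x∈p∪q⁺ {p = F} (inj₂ h))))

  ρP-subadditive : ∀ Z W → ρP (Z ∪ W) ≤ ρP Z + ∣ W ∣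
  ρP-subadditive Z W = ≤-trans (⊓-mono-≤ (Sα.subadditive α≤∣_∣ Z W) (β-subadditive Z W))
                               (≤-reflexive (sym (+-distribʳ-⊓ ∣ W ∣ (α Z) (β Z))))

  -- The T-part of α - β, namely q(G - B) + |G ∩ B| - q(G), is monotone in G:
  -- growing G by G' costs at most as much in N as it gains in the count.
  T-excess-mono : ∀ {G G'} → G ⊆ G' →
    q (G ∩ ∁ B) + ∣ G ∩ B ∣ + q G' ≤ q (G' ∩ ∁ B) + ∣ G' ∩ B ∣ + q G
  T-excess-mono {G} {G'} G⊆G' = begin
    q (G ∩ ∁ B) + ∣ G ∩ B ∣ + q G'
      ≤⟨ +-mono-≤ (+-mono-≤ (NR.ρ-mono (λ h → let a , b = x∈p∩q⁻ G (∁ B) h in x∈p∩q⁺ (a , x∈p∩q⁺ (G⊆G' a , b))))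
                            (p⊆q⇒∣p∣≤∣q∣ (λ h → let a , b = x∈p∩q⁻ G B h in x∈p∩q⁺ (x∈p∩q⁺ (G⊆G' a , b) , a))))
                  (≤-trans (NR.ρ-mono G'⊆) (NR.subadditive W D)) ⟩
    q (G ∩ (G' ∩ ∁ B)) + ∣ (G' ∩ B) ∩ G ∣ + (q W + ∣ D ∣)
      ≡⟨ solve 4 (λ a b c d → a :+ b :+ (c :+ d) := (c :+ a) :+ (b :+ d)) refl
           (q (G ∩ (G' ∩ ∁ B))) (∣ (G' ∩ B) ∩ G ∣) (q W) (∣ D ∣) ⟩
    (q W + q (G ∩ (G' ∩ ∁ B))) + (∣ (G' ∩ B) ∩ G ∣ + ∣ D ∣)
      ≤⟨ +-mono-≤ (NR.submodular G (G' ∩ ∁ B)) (≤-reflexive (sym (∣p∣-split (G' ∩ B) G))) ⟩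
    (q G + q (G' ∩ ∁ B)) + ∣ G' ∩ B ∣
      ≡⟨ solve 3 (λ a b c → (a :+ b) :+ c := b :+ c :+ a) refl (q G) (q (G' ∩ ∁ B)) ∣ G' ∩ B ∣ ⟩
    q (G' ∩ ∁ B) + ∣ G' ∩ B ∣ + q G ∎
    where
    open ≤-Reasoning
    open +-*-Solver
    W = G ∪ (G' ∩ ∁ B)
    D = (G' ∩ B) ∩ ∁ G
    G'⊆ : G' ⊆ W ∪ D
    G'⊆ {x} h with x ∈? B | x ∈? G
    ... | _ | yes x∈G = x∈p∪q⁺ (inj₁ (x∈p∪q⁺ (inj₁ x∈G)))
    ... | yes x∈B | no x∉G = x∈p∪q⁺ (inj₂ (x∈p∩q⁺ (x∈p∩q⁺ (h , x∈B) , x∉p⇒x∈∁p x∉G)))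
    ... | no x∉B | no x∉G = x∈p∪q⁺ (inj₁ (x∈p∪q⁺ (inj₂ (x∈p∩q⁺ (h , x∉p⇒x∈∁p x∉B)))))

  -- α - β is monotone: the S-part by diminishing returns for adding A in M.
  α-β-mono : ∀ {U V} → U ⊆ V → α U + β V ≤ α V + β U
  α-β-mono {U} {V} U⊆V = begin
    (r F + q (G ∩ ∁ B) + ∣ G ∩ B ∣) + (r (F' ∪ A) + q G')
      ≡⟨ solve 5 (λ a b c d e → (a :+ b :+ c) :+ (d :+ e) := (a :+ d) :+ (b :+ c :+ e)) refl
           (r F) (q (G ∩ ∁ B)) ∣ G ∩ B ∣ (r (F' ∪ A)) (q G') ⟩
    (r F + r (F' ∪ A)) + (q (G ∩ ∁ B) + ∣ G ∩ B ∣ + q G')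
      ≤⟨ +-mono-≤ (subst (_≤ r F' + r (F ∪ A)) (+-comm (r (F' ∪ A)) (r F)) (MR.diminishing A (take-mono U⊆V)))
                  (T-excess-mono (drop-mono U⊆V)) ⟩
    (r F' + r (F ∪ A)) + (q (G' ∩ ∁ B) + ∣ G' ∩ B ∣ + q G)
      ≡⟨ solve 5 (λ a b c d e → (a :+ d) :+ (b :+ c :+ e) := (a :+ b :+ c) :+ (d :+ e)) refl
           (r F') (q (G' ∩ ∁ B)) ∣ G' ∩ B ∣ (r (F ∪ A)) (q G) ⟩
    (r F' + q (G' ∩ ∁ B) + ∣ G' ∩ B ∣) + (r (F ∪ A) + q G) ∎
    where
    open ≤-Reasoning
    open +-*-Solver
    F = take m U
    G = drop m U
    F' = take m V
    G' = drop m V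

  open RankFunction IP ρP ρP-spec public

  -- Independence in P is closed under subsets, via ρP(J ∪ (I - J)) ≤ ρP J + |I - J|.
  IP-⊆ : ∀ {I J} → J ⊆ I → IP I → IP J
  IP-⊆ {I} {J} J⊆I indI = ∣∣≤ρ⇒indep (+-cancelʳ-≤ ∣ I ∩ ∁ J ∣ _ _ (begin
    ∣ J ∣ + ∣ I ∩ ∁ J ∣          ≡⟨ cong (_+ ∣ I ∩ ∁ J ∣) (∣-∣-cong (λ h → x∈p∩q⁺ (J⊆I h , h)) (p∩q⊆q I J)) ⟩
    ∣ I ∩ J ∣ + ∣ I ∩ ∁ J ∣      ≡⟨ sym (∣p∣-split I J) ⟩
    ∣ I ∣                        ≤⟨ indep⇒∣∣≤ρ indI ⟩
    ρP I                         ≤⟨ ρ-mono I⊆ ⟩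
    ρP (J ∪ (I ∩ ∁ J))           ≤⟨ ρP-subadditive J (I ∩ ∁ J) ⟩
    ρP J + ∣ I ∩ ∁ J ∣ ∎))
    where
    open ≤-Reasoning
    I⊆ : I ⊆ J ∪ (I ∩ ∁ J)
    I⊆ {x} h with x ∈? J
    ... | yes x∈J = x∈p∪q⁺ (inj₁ x∈J)
    ... | no x∉J = x∈p∪q⁺ (inj₂ (x∈p∩q⁺ (h , x∉p⇒x∈∁p x∉J)))

  open Circuits IP-⊆ public

  circuit-redundant : ∀ {C Z e} → Circuit IP C → e ∈ C → C ⊆ Z → ρP (Z - e) ≡ ρP Z
  circuit-redundant {C} {Z} {e} circC e∈C C⊆Z = ≤-antisym (ρ-mono (p─q⊆p Z ⁅ e ⁆))
    (min-rank-step {α U} {α C} {α V} {α Z} {β U} {β C} {β V} {β Z}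
      (α-mono U⊆C) (β-mono U⊆C)
      (≤-trans (+-monoˡ-≤ (α U) (α-mono Z⊆)) (≤-trans (Sα.diminishing ⁅ e ⁆ U⊆V) (+-monoʳ-≤ (α V) (α-mono Ue⊆C))))
      (≤-trans (+-monoˡ-≤ (β U) (β-mono Z⊆)) (≤-trans (Sβ.diminishing ⁅ e ⁆ U⊆V) (+-monoʳ-≤ (β V) (β-mono Ue⊆C))))
      (α-β-mono U⊆V) (α-β-mono U⊆C) (proj₁ (circuit-rank circC e∈C)))
    where
    U = C - e
    V = Z - e
    U⊆C : U ⊆ C
    U⊆C = p─q⊆p C ⁅ e ⁆
    U⊆V : U ⊆ V
    U⊆V h = let a , b = x∈p-y⁻ C h in x∈p∧x≢y⇒x∈p-y (C⊆Z a) b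
    Z⊆ : Z ⊆ V ∪ ⁅ e ⁆
    Z⊆ = ⊆-del-add Z e
    Ue⊆C : U ∪ ⁅ e ⁆ ⊆ C
    Ue⊆C = ∪-lub U⊆C (λ h → subst (_∈ C) (sym (x∈⁅y⁆⇒x≡y e h)) e∈C)

  open ByRank circuit-redundant public

module CyclicFlatsOfP {m n : ℕ} (M : Matroid m) (N : Matroid n) (A : Subset m) (B : Subset n) where
  open Parts m n
  open PrincipalSumRank M N A B
  module PM = PrincipalSumMatroid M N A B

  CyclicFlatPair : Subset m → Subset n → Set
  CyclicFlatPair F G = (∀ i → i ∈ F → ρₚ (F - i) G ≡ ρₚ F G)
                     × (∀ j → j ∈ G → ρₚ F (G - j) ≡ ρₚ F G)
                     × (∀ i → i ∉ F → ρₚ F G < ρₚ (F ∪ ⁅ i ⁆) G)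
                     × (∀ j → j ∉ G → ρₚ F G < ρₚ F (G ∪ ⁅ j ⁆))

  ρP-parts : ∀ {Z F G} → take m Z ≡ F × drop m Z ≡ G → ρP Z ≡ ρₚ F G
  ρP-parts (refl , refl) = refl

  cyclicFlat⇒pair : ∀ Z → CyclicFlat IP Z → CyclicFlatPair (take m Z) (drop m Z)
  cyclicFlat⇒pair Z (flatZ , cycZ) =
    (λ i i∈F → trans (sym (ρP-parts (parts-del-S Z i))) (redundant (i ↑ˡ n) (∈take⁻ Z i∈F))) ,
    (λ j j∈G → trans (sym (ρP-parts (parts-del-T Z j))) (redundant (m ↑ʳ j) (∈drop⁻ Z j∈G))) ,
    (λ i i∉F → subst (ρP Z <_) (ρP-parts (parts-add-S Z i)) (raises (i ↑ˡ n) ∈⊤ (λ h → i∉F (∈take⁺ Z h)))) ,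
    (λ j j∉G → subst (ρP Z <_) (ρP-parts (parts-add-T Z j)) (raises (m ↑ʳ j) ∈⊤ (λ h → j∉G (∈drop⁺ Z h))))
    where
    redundant : PM.RankCyclic Z
    redundant = PM.cyclic⇒rankCyclic cycZ
    raises : ∀ x → x ∈ ⊤ → x ∉ Z → ρP Z < ρP (Z ∪ ⁅ x ⁆)
    raises = proj₂ (PM.flat⇒rankFlat flatZ)

  pair⇒cyclicFlat : ∀ Z → CyclicFlatPair (take m Z) (drop m Z) → CyclicFlat IP Z
  pair⇒cyclicFlat Z (redS , redT , raiseS , raiseT) =
    PM.rankFlat⇒flat (⊆⊤ , raises) , PM.rankCyclic⇒cyclic redundant
    where
    redundant : ∀ e → e ∈ Z → ρP (Z - e) ≡ ρP Z
    redundant e e∈Z with splitView m n e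
    ... | inS i = trans (ρP-parts (parts-del-S Z i)) (redS i (∈take⁺ Z e∈Z))
    ... | inT j = trans (ρP-parts (parts-del-T Z j)) (redT j (∈drop⁺ Z e∈Z))
    raises : ∀ x → x ∈ ⊤ → x ∉ Z → ρP Z < ρP (Z ∪ ⁅ x ⁆)
    raises x _ x∉Z with splitView m n x
    ... | inS i = subst (ρP Z <_) (sym (ρP-parts (parts-add-S Z i))) (raiseS i (λ h → x∉Z (∈take⁻ Z h)))
    ... | inT j = subst (ρP Z <_) (sym (ρP-parts (parts-add-T Z j))) (raiseT j (λ h → x∉Z (∈drop⁻ Z h)))

  cyclicFlat⇔pair : ∀ F G → CyclicFlat IP (F ++ G) ⇔ CyclicFlatPair F G
  cyclicFlat⇔pair F G = mk⇔
    (λ cf → subst₂ CyclicFlatPair (take-++ F G) (drop-++ F G) (cyclicFlat⇒pair (F ++ G) cf))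
    (λ p → pair⇒cyclicFlat (F ++ G) (subst₂ CyclicFlatPair (sym (take-++ F G)) (sym (drop-++ F G)) p))

module PairEstimates {m n : ℕ} (M : Matroid m) (N : Matroid n) (A : Subset m) (B : Subset n) where
  open PrincipalSumRank M N A B
  open PrincipalSumMatroid M N A B using (αₚ-mono; βₚ-mono; ρₚ-mono)

  αₚ-off-B : ∀ F G → (∀ {t} → t ∈ G → t ∉ B) → αₚ F G ≡ r F + q G
  αₚ-off-B F G G∩B≡∅ = trans (cong₂ (λ u v → r F + u + v)
      (NR.ρ-cong (p∩q⊆p G (∁ B)) (λ h → x∈p∩q⁺ (h , x∉p⇒x∈∁p (G∩B≡∅ h))))
      (trans (cong ∣_∣ (Empty-unique λ { (t , h) → let a , b = x∈p∩q⁻ G B h in G∩B≡∅ a b })) (∣⊥∣≡0 n)))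
    (+-identityʳ _)

  βₚ-over-A : ∀ F G → A ⊆ F → βₚ F G ≡ r F + q G
  βₚ-over-A F G A⊆F = cong (_+ q G) (MR.ρ-cong (∪-lub (λ h → h) A⊆F) (p⊆p∪q A))

  αₚ-del-S : ∀ F G s → αₚ F G ≤ suc (αₚ (F - s) G)
  αₚ-del-S F G s = +-monoˡ-≤ ∣ G ∩ B ∣ (+-monoˡ-≤ (q (G ∩ ∁ B)) (MR.rk-─⁅e⁆ F s))

  βₚ-del-S : ∀ F G s → βₚ F G ≤ suc (βₚ (F - s) G)
  βₚ-del-S F G s = +-monoˡ-≤ (q G) (≤-trans (MR.ρ-mono F∪A⊆) (MR.rk-∪⁅e⁆ ((F - s) ∪ A) s))
    where
    F∪A⊆ : F ∪ A ⊆ ((F - s) ∪ A) ∪ ⁅ s ⁆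
    F∪A⊆ = ∪-lub (λ h → ∪-mono (λ h' → x∈p∪q⁺ (inj₁ h')) (λ h' → h') (⊆-del-add F s h))
                 (λ h → x∈p∪q⁺ (inj₁ (x∈p∪q⁺ (inj₂ h))))

  βₚ-del-T : ∀ F G t → βₚ F G ≤ suc (βₚ F (G - t))
  βₚ-del-T F G t = ≤-trans (+-monoʳ-≤ (r (F ∪ A)) (NR.rk-─⁅e⁆ G t)) (≤-reflexive (+-suc _ _))

  αₚ-del-T : ∀ F G t → αₚ F G ≤ suc (αₚ F (G - t))
  αₚ-del-T F G t with t ∈? B
  ... | yes t∈B = ≤-trans (+-monoʳ-≤ (r F + q (G ∩ ∁ B)) count)
                    (≤-trans (+-monoˡ-≤ (suc ∣ (G - t) ∩ B ∣) (+-monoʳ-≤ (r F) (NR.ρ-mono G-B⊆)))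
                             (≤-reflexive (+-suc _ _)))
    where
    G-B⊆ : G ∩ ∁ B ⊆ (G - t) ∩ ∁ B
    G-B⊆ {x} h = let a , b = x∈p∩q⁻ G (∁ B) h in
      x∈p∩q⁺ (x∈p∧x≢y⇒x∈p-y a (λ { refl → x∈∁p⇒x∉p b t∈B }) , b)
    count : ∣ G ∩ B ∣ ≤ suc ∣ (G - t) ∩ B ∣
    count = ≤-trans (p⊆q⇒∣p∣≤∣q∣ G∩B⊆) (≤-trans (∣p∪q∣≤∣p∣+∣q∣ ((G - t) ∩ B) ⁅ t ⁆)
              (≤-reflexive (trans (cong (∣ (G - t) ∩ B ∣ +_) (∣⁅x⁆∣≡1 t)) (+-comm _ 1))))
      where
      G∩B⊆ : G ∩ B ⊆ ((G - t) ∩ B) ∪ ⁅ t ⁆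
      G∩B⊆ = ⊆-trans (∩-mono (⊆-del-add G t) (λ h → h))
               (⊆-trans (⊆-reflexive (∩-distribʳ-∪ B (G - t) ⁅ t ⁆)) (∪-mono (λ h → h) (p∩q⊆p ⁅ t ⁆ B)))
  ... | no t∉B = ≤-trans (+-mono-≤ (+-monoʳ-≤ (r F) (≤-trans (NR.ρ-mono G-B⊆) (NR.rk-∪⁅e⁆ ((G - t) ∩ ∁ B) t)))
                                   (p⊆q⇒∣p∣≤∣q∣ G∩B⊆))
                         (≤-reflexive (cong (_+ ∣ (G - t) ∩ B ∣) (+-suc _ _)))
    where
    G-B⊆ : G ∩ ∁ B ⊆ ((G - t) ∩ ∁ B) ∪ ⁅ t ⁆
    G-B⊆ = ⊆-trans (∩-mono (⊆-del-add G t) (λ h → h))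
             (⊆-trans (⊆-reflexive (∩-distribʳ-∪ (∁ B) (G - t) ⁅ t ⁆)) (∪-mono (λ h → h) (p∩q⊆p ⁅ t ⁆ (∁ B))))
    G∩B⊆ : G ∩ B ⊆ (G - t) ∩ B
    G∩B⊆ {x} h = let a , b = x∈p∩q⁻ G B h in
      x∈p∩q⁺ (x∈p∧x≢y⇒x∈p-y a (λ { refl → t∉B b }) , b)

  -- When G avoids B, adding t ∉ G raises αₚ above r F + q G: through the count
  -- if t ∈ B, and through q if t ∉ B and t raises the rank of G.
  αₚ-raise-T : ∀ F G t → (∀ {g} → g ∈ G → g ∉ B) → (t ∉ B → q G < q (G ∪ ⁅ t ⁆)) →
               r F + q G < αₚ F (G ∪ ⁅ t ⁆)
  αₚ-raise-T F G t G∩B≡∅ raises with t ∈? B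
  ... | yes t∈B = begin-strict
      r F + q G                         ≡⟨ cong (r F +_) (sym q[G-B]≡) ⟩
      r F + q (G ∩ ∁ B)                 ≤⟨ +-monoʳ-≤ (r F) (NR.ρ-mono (∩-mono (p⊆p∪q ⁅ t ⁆) (λ h → h))) ⟩
      r F + q ((G ∪ ⁅ t ⁆) ∩ ∁ B)       <⟨ m<m+n _ (≤-trans (≤-reflexive (sym (∣⁅x⁆∣≡1 t)))
                                             (p⊆q⇒∣p∣≤∣q∣ λ h → x∈p∩q⁺ (x∈p∪q⁺ {p = G} (inj₂ h) ,
                                                 subst (_∈ B) (sym (x∈⁅y⁆⇒x≡y t h)) t∈B))) ⟩
      αₚ F (G ∪ ⁅ t ⁆) ∎
    where
    open ≤-Reasoning
    q[G-B]≡ : q (G ∩ ∁ B) ≡ q G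
    q[G-B]≡ = NR.ρ-cong (p∩q⊆p G (∁ B)) (λ h → x∈p∩q⁺ (h , x∉p⇒x∈∁p (G∩B≡∅ h)))
  ... | no t∉B = ≤-trans (+-monoʳ-< (r F) (raises t∉B))
                   (≤-trans (+-monoʳ-≤ (r F) (NR.ρ-mono G∪t⊆)) (m≤m+n _ _))
    where
    G∪t⊆ : G ∪ ⁅ t ⁆ ⊆ (G ∪ ⁅ t ⁆) ∩ ∁ B
    G∪t⊆ h = x∈p∩q⁺ (h , ∪-lub (λ h' → x∉p⇒x∈∁p (G∩B≡∅ h'))
                               (λ h' → subst (_∈ ∁ B) (sym (x∈⁅y⁆⇒x≡y t h')) (x∉p⇒x∈∁p t∉B)) h)

  ρₚ-same : ∀ {F G F' G'} → F' ⊆ F → G' ⊆ G → ρₚ F G ≤ αₚ F' G' → ρₚ F G ≤ βₚ F' G' → ρₚ F' G' ≡ ρₚ F G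
  ρₚ-same F'⊆F G'⊆G ≤α ≤β = ≤-antisym (ρₚ-mono F'⊆F G'⊆G) (⊓-glb ≤α ≤β)

  ρₚ-raise : ∀ {F G F' G'} → ρₚ F G < αₚ F' G' → ρₚ F G < βₚ F' G' → ρₚ F G < ρₚ F' G'
  ρₚ-raise = ⊓-glb

module ThreeKinds {m n : ℕ} (M : Matroid m) (N : Matroid n) (A : Subset m) (B : Subset n) where
  open PrincipalSumRank M N A B
  open PrincipalSumMatroid M N A B using (αₚ-mono; βₚ-mono)
  open CyclicFlatsOfP M N A B using (CyclicFlatPair; cyclicFlat⇔pair)
  open PairEstimates M N A B

  Kind₁ Kind₂ Kind₃ : Subset m → Subset n → Set
  Kind₁ F G = CyclicFlat (Indep M) F × ¬ (A ⊆ F) × CyclicFlatIn (Indep N) (∁ B) G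
  Kind₂ F G = Flat (Indep M) F × A ⊆ F × (∀ x → ColoopIn (Indep M) F x → x ∈ A)
              × CyclicFlat (Indep N) G × G ∩ B ≢ ⊥
  Kind₃ F G = CyclicFlat (Indep M) F × A ⊆ F × CyclicFlat (Indep N) G × G ∩ B ≡ ⊥

  -- The S-part of a cyclic flat of P is a flat of M: if i did not raise r F,
  -- by diminishing returns it would not raise r(F ∪ A) either.
  pair⇒flatM : ∀ {F G} → CyclicFlatPair F G → Flat (Indep M) F
  pair⇒flatM {F} {G} (_ , _ , raiseS , _) = MR.rankFlat⇒flat (⊆⊤ , λ i _ i∉F →
      ≰⇒> λ noGain → <⇒≱ (raiseS i i∉F)
        (⊓-mono-≤ (+-monoˡ-≤ ∣ G ∩ B ∣ (+-monoˡ-≤ (q (G ∩ ∁ B)) noGain)) (+-monoˡ-≤ (q G) (noGainA i noGain))))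
    where
    noGainA : ∀ i → r (F ∪ ⁅ i ⁆) ≤ r F → r ((F ∪ ⁅ i ⁆) ∪ A) ≤ r (F ∪ A)
    noGainA i noGain = ≤-trans (MR.ρ-mono F∪i∪A⊆) (+-cancelʳ-≤ (r F) _ _
      (≤-trans (MR.diminishing ⁅ i ⁆ (p⊆p∪q {p = F} A)) (+-monoʳ-≤ (r (F ∪ A)) noGain)))
      where
      F∪i∪A⊆ : (F ∪ ⁅ i ⁆) ∪ A ⊆ (F ∪ A) ∪ ⁅ i ⁆
      F∪i∪A⊆ = ∪-lub (∪-mono (p⊆p∪q A) (λ h → h)) (λ h → x∈p∪q⁺ (inj₁ (x∈p∪q⁺ {p = F} (inj₂ h))))

  -- If G meets B, then β realises ρₚ (deleting j ∈ G ∩ B drops α but not ρₚ),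
  -- and the conditions on ρₚ = r(F ∪ A) + q G give the second kind.
  pair-meeting-B : ∀ {F G j} → CyclicFlatPair F G → j ∈ G ∩ B → Kind₂ F G
  pair-meeting-B {F} {G} {j} pair@(redS , redT , raiseS , raiseT) j∈G∩B =
    pair⇒flatM pair , A⊆F , coloops-in-A , (flatN , cyclicN) , λ G∩B≡⊥ → ∉⊥ (subst (j ∈_) G∩B≡⊥ j∈G∩B)
    where
    j∈G : j ∈ G
    j∈G = proj₁ (x∈p∩q⁻ G B j∈G∩B)
    α-drop : suc (αₚ F (G - j)) ≤ αₚ F G
    α-drop = ≤-trans (≤-reflexive (sym (+-suc _ _)))
      (+-mono-≤ (+-monoʳ-≤ (r F) (NR.ρ-mono (∩-mono (p─q⊆p G ⁅ j ⁆) (λ h → h))))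
                (≤-trans (s≤s (p⊆q⇒∣p∣≤∣q∣ (λ h → let a , b = x∈p∩q⁻ (G - j) B h ; a₁ , a₂ = x∈p-y⁻ G a
                                                   in x∈p∧x≢y⇒x∈p-y (x∈p∩q⁺ (a₁ , b)) a₂)))
                         (≤-reflexive (∣p-x∣ (G ∩ B) j∈G∩B))))
    β<α : βₚ F G < αₚ F G
    β<α = ≰⇒> λ α≤β → <-irrefl refl (≤-trans (s≤s (≤-trans (≤-reflexive
            (trans (sym (m≤n⇒m⊓n≡m α≤β)) (sym (redT j j∈G)))) (m⊓n≤m _ _))) α-drop)
    ρ≡β : ρₚ F G ≡ βₚ F G
    ρ≡β = m≥n⇒m⊓n≡n (<⇒≤ β<α)
    A⊆F : A ⊆ F
    A⊆F {i} i∈A = decidable-stable (i ∈? F) λ i∉F → <⇒≱ (raiseS i i∉F)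
      (≤-trans (m⊓n≤n _ _) (≤-trans (≤-reflexive (cong (_+ q G) (MR.ρ-cong F∪i∪A⊆ (∪-mono (p⊆p∪q ⁅ i ⁆) (λ h → h)))))
         (≤-reflexive (sym ρ≡β))))
      where
      F∪i∪A⊆ : (F ∪ ⁅ i ⁆) ∪ A ⊆ F ∪ A
      F∪i∪A⊆ = ∪-lub (∪-lub (p⊆p∪q A) (λ h → x∈p∪q⁺ {p = F} (inj₂ (subst (_∈ A) (sym (x∈⁅y⁆⇒x≡y i h)) i∈A))))
                     (λ h → x∈p∪q⁺ {p = F} (inj₂ h))
    -- a coloop x ∉ A of M|F would lower r(F ∪ A) when deleted
    coloops-in-A : ∀ x → ColoopIn (Indep M) F x → x ∈ A
    coloops-in-A x coloop = decidable-stable (x ∈? A) λ x∉A → <⇒≱ (MR.coloop⇒rank-drop coloop)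
      (≤-trans (MR.ρ-mono (p⊆p∪q A)) (≤-trans
        (+-cancelʳ-≤ (q G) _ _ (≤-trans (≤-reflexive (trans (sym ρ≡β) (sym (redS x (proj₁ coloop))))) (m⊓n≤n _ _)))
        (MR.ρ-mono (∪-lub (λ h → h) (λ {y} h → x∈p∧x≢y⇒x∈p-y (A⊆F h) (λ { refl → x∉A h }))))))
    cyclicN : Cyclic (Indep N) G
    cyclicN = NR.rankCyclic⇒cyclic λ t t∈G → ≤-antisym (NR.ρ-mono (p─q⊆p G ⁅ t ⁆)) (+-cancelˡ-≤ (r (F ∪ A)) _ _
      (≤-trans (≤-reflexive (trans (sym ρ≡β) (sym (redT t t∈G)))) (m⊓n≤n _ _)))
    flatN : Flat (Indep N) G
    flatN = NR.rankFlat⇒flat (⊆⊤ , λ t _ t∉G → +-cancelˡ-< (r (F ∪ A)) _ _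
      (<-≤-trans (subst (_< ρₚ F (G ∪ ⁅ t ⁆)) ρ≡β (raiseT t t∉G)) (m⊓n≤n _ _)))

  -- If G avoids B, then α = r F + q G realises ρₚ, F and G are cyclic flats
  -- of M and N, and A ⊆ F decides between the third and first kinds (in the
  -- first, only elements outside B are needed to raise α, so G is a flat of N\B).
  pair-avoiding-B : ∀ {F G} → CyclicFlatPair F G → (∀ {t} → t ∈ G → t ∉ B) → Kind₁ F G ⊎ Kind₃ F G
  pair-avoiding-B {F} {G} pair@(redS , redT , raiseS , raiseT) G∩B≡∅ = decide (A ⊆? F)
    where
    ρ≡r+q : ρₚ F G ≡ r F + q G
    ρ≡r+q = trans (m≤n⇒m⊓n≡m (≤-trans (≤-reflexive (αₚ-off-B F G G∩B≡∅)) (+-monoˡ-≤ (q G) (MR.ρ-mono (p⊆p∪q A)))))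
                  (αₚ-off-B F G G∩B≡∅)
    cyclicN : Cyclic (Indep N) G
    cyclicN = NR.rankCyclic⇒cyclic λ t t∈G → ≤-antisym (NR.ρ-mono (p─q⊆p G ⁅ t ⁆)) (+-cancelˡ-≤ (r F) _ _
      (≤-trans (≤-reflexive (trans (sym ρ≡r+q) (sym (redT t t∈G))))
               (≤-trans (m⊓n≤m _ _) (≤-reflexive (αₚ-off-B F (G - t) (λ h → G∩B≡∅ (proj₁ (x∈p-y⁻ G h))))))))
    cyclicFlatM : CyclicFlat (Indep M) F
    cyclicFlatM = pair⇒flatM pair , MR.rankCyclic⇒cyclic λ s s∈F → ≤-antisym (MR.ρ-mono (p─q⊆p F ⁅ s ⁆))
      (+-cancelʳ-≤ (q G) _ _ (≤-trans (≤-reflexive (trans (sym ρ≡r+q) (sym (redS s s∈F))))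
                                       (≤-trans (m⊓n≤m _ _) (≤-reflexive (αₚ-off-B (F - s) G G∩B≡∅)))))
    decide : Dec (A ⊆ F) → Kind₁ F G ⊎ Kind₃ F G
    decide (yes A⊆F) =
      inj₂ (cyclicFlatM , A⊆F , (flatN , cyclicN) , Empty-unique λ { (t , h) → let a , b = x∈p∩q⁻ G B h in G∩B≡∅ a b })
      where
      flatN : Flat (Indep N) G
      flatN = NR.rankFlat⇒flat (⊆⊤ , λ t _ t∉G → +-cancelˡ-< (r F) _ _
        (<-≤-trans (subst (_< ρₚ F (G ∪ ⁅ t ⁆)) ρ≡r+q (raiseT t t∉G))
                   (≤-trans (m⊓n≤n _ _) (≤-reflexive (βₚ-over-A F (G ∪ ⁅ t ⁆) A⊆F)))))
    decide (no A⊈F) = inj₁ (cyclicFlatM , A⊈F , (flatN∖B , cyclicN))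
      where
      flatN∖B : FlatIn (Indep N) (∁ B) G
      flatN∖B = NR.rankFlat⇒flat ((λ h → x∉p⇒x∈∁p (G∩B≡∅ h)) , λ t t∉B t∉G → +-cancelˡ-< (r F) _ _
        (<-≤-trans (subst (_< ρₚ F (G ∪ ⁅ t ⁆)) ρ≡r+q (raiseT t t∉G))
                   (≤-trans (m⊓n≤m _ _) (≤-reflexive (αₚ-off-B F (G ∪ ⁅ t ⁆) λ h → x∈∁p⇒x∉p
                     (∪-lub (λ h' → x∉p⇒x∈∁p (G∩B≡∅ h')) (λ h' → subst (_∈ ∁ B) (sym (x∈⁅y⁆⇒x≡y t h')) t∉B) h))))))

  pair⇒kind : ∀ F G → CyclicFlatPair F G → Kind₁ F G ⊎ Kind₂ F G ⊎ Kind₃ F G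
  pair⇒kind F G pair with nonempty? (G ∩ B)
  ... | yes (j , j∈G∩B) = inj₂ (inj₁ (pair-meeting-B pair j∈G∩B))
  ... | no G∩B≡∅ with pair-avoiding-B pair (λ t∈G t∈B → G∩B≡∅ (_ , x∈p∩q⁺ (t∈G , t∈B)))
  ...   | inj₁ kind₁ = inj₁ kind₁
  ...   | inj₂ kind₃ = inj₂ (inj₂ kind₃)

  -- First kind: some i ∈ A - F makes α < β, so ρₚ = α = r F + q G.
  kind₁⇒pair : ∀ F G → Kind₁ F G → CyclicFlatPair F G
  kind₁⇒pair F G ((flatM , cyclicM) , A⊈F , (flatN∖B , cyclicN)) = redS , redT , raiseS , raiseT
    where
    G∩B≡∅ : ∀ {t} → t ∈ G → t ∉ B
    G∩B≡∅ h = x∈∁p⇒x∉p (proj₁ flatN∖B h)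
    α≡ : αₚ F G ≡ r F + q G
    α≡ = αₚ-off-B F G G∩B≡∅
    witness : ∃[ i ] (i ∈ A × i ∉ F)
    witness = ⊈⇒witness A F A⊈F
    i : Fin m
    i = proj₁ witness
    α<β : αₚ F G < βₚ F G
    α<β = subst (_< βₚ F G) (sym α≡) (+-monoˡ-< (q G)
      (<-≤-trans (proj₂ (MR.flat⇒rankFlat flatM) i ∈⊤ (proj₂ (proj₂ witness)))
                 (MR.ρ-mono (∪-mono (λ h → h) (λ h → subst (_∈ A) (sym (x∈⁅y⁆⇒x≡y i h)) (proj₁ (proj₂ witness)))))))
    ρ≡α : ρₚ F G ≡ αₚ F G
    ρ≡α = m≤n⇒m⊓n≡m (<⇒≤ α<β)
    redS : ∀ s → s ∈ F → ρₚ (F - s) G ≡ ρₚ F G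
    redS s s∈F = ρₚ-same (p─q⊆p F ⁅ s ⁆) (λ h → h)
      (≤-reflexive (trans ρ≡α (cong (λ z → z + q (G ∩ ∁ B) + ∣ G ∩ B ∣) (sym (MR.cyclic⇒rankCyclic cyclicM s s∈F)))))
      (≤-trans (≤-reflexive ρ≡α) (≤-pred (≤-trans α<β (βₚ-del-S F G s))))
    raiseS : ∀ s → s ∉ F → ρₚ F G < ρₚ (F ∪ ⁅ s ⁆) G
    raiseS s s∉F = ρₚ-raise
      (subst (_< αₚ (F ∪ ⁅ s ⁆) G) (sym ρ≡α)
        (+-monoˡ-< ∣ G ∩ B ∣ (+-monoˡ-< (q (G ∩ ∁ B)) (proj₂ (MR.flat⇒rankFlat flatM) s ∈⊤ s∉F))))
      (subst (_< βₚ (F ∪ ⁅ s ⁆) G) (sym ρ≡α) (<-≤-trans α<β (βₚ-mono (p⊆p∪q ⁅ s ⁆) (λ h → h))))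
    redT : ∀ t → t ∈ G → ρₚ F (G - t) ≡ ρₚ F G
    redT t t∈G = ρₚ-same (λ h → h) (p─q⊆p G ⁅ t ⁆)
      (≤-reflexive (trans (trans ρ≡α α≡) (trans (cong (r F +_) (sym (NR.cyclic⇒rankCyclic cyclicN t t∈G)))
                                               (sym (αₚ-off-B F (G - t) (λ h → G∩B≡∅ (proj₁ (x∈p-y⁻ G h))))))))
      (≤-trans (≤-reflexive ρ≡α) (≤-pred (≤-trans α<β (βₚ-del-T F G t))))
    raiseT : ∀ t → t ∉ G → ρₚ F G < ρₚ F (G ∪ ⁅ t ⁆)
    raiseT t t∉G = ρₚ-raise
      (subst (_< αₚ F (G ∪ ⁅ t ⁆)) (sym (trans ρ≡α α≡))
        (αₚ-raise-T F G t G∩B≡∅ (λ t∉B → proj₂ (NR.flat⇒rankFlat flatN∖B) t (x∉p⇒x∈∁p t∉B) t∉G)))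
      (subst (_< βₚ F (G ∪ ⁅ t ⁆)) (sym ρ≡α) (<-≤-trans α<β (βₚ-mono (λ h → h) (p⊆p∪q ⁅ t ⁆))))

  -- Second kind: an element j ∈ G ∩ B is redundant in N but counted in α, so
  -- β < α and ρₚ = β = r F + q G; coloops of M|F outside A would break redundancy.
  kind₂⇒pair : ∀ F G → Kind₂ F G → CyclicFlatPair F G
  kind₂⇒pair F G (flatM , A⊆F , coloops-in-A , (flatN , cyclicN) , G∩B≢⊥) = redS , redT , raiseS , raiseT
    where
    β≡ : βₚ F G ≡ r F + q G
    β≡ = βₚ-over-A F G A⊆F
    meet : ∃[ j ] (j ∈ G ∩ B)
    meet with nonempty? (G ∩ B)
    ... | yes w = w
    ... | no G∩B≡∅ = ⊥-elim (G∩B≢⊥ (Empty-unique G∩B≡∅))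
    j : Fin n
    j = proj₁ meet
    j∈G∩B : j ∈ G ∩ B
    j∈G∩B = proj₂ meet
    qG< : q G < q (G ∩ ∁ B) + ∣ G ∩ B ∣
    qG< = begin-strict
      q G                            ≡⟨ sym (NR.cyclic⇒rankCyclic cyclicN j (proj₁ (x∈p∩q⁻ G B j∈G∩B))) ⟩
      q (G - j)                      ≤⟨ NR.ρ-mono G-j⊆ ⟩
      q ((G ∩ ∁ B) ∪ ((G ∩ B) - j))  ≤⟨ NR.subadditive (G ∩ ∁ B) ((G ∩ B) - j) ⟩
      q (G ∩ ∁ B) + ∣ (G ∩ B) - j ∣  <⟨ +-monoʳ-< (q (G ∩ ∁ B)) (≤-reflexive (∣p-x∣ (G ∩ B) j∈G∩B)) ⟩
      q (G ∩ ∁ B) + ∣ G ∩ B ∣ ∎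
      where
      open ≤-Reasoning
      G-j⊆ : G - j ⊆ (G ∩ ∁ B) ∪ ((G ∩ B) - j)
      G-j⊆ {x} h with x∈p-y⁻ G h | x ∈? B
      ... | x∈G , x≢j | yes x∈B = x∈p∪q⁺ (inj₂ (x∈p∧x≢y⇒x∈p-y (x∈p∩q⁺ (x∈G , x∈B)) x≢j))
      ... | x∈G , _   | no x∉B = x∈p∪q⁺ (inj₁ (x∈p∩q⁺ (x∈G , x∉p⇒x∈∁p x∉B)))
    β<α : βₚ F G < αₚ F G
    β<α = subst₂ _<_ (sym β≡) (sym (+-assoc (r F) _ _)) (+-monoʳ-< (r F) qG<)
    ρ≡β : ρₚ F G ≡ βₚ F G
    ρ≡β = m≥n⇒m⊓n≡n (<⇒≤ β<α)
    redS : ∀ s → s ∈ F → ρₚ (F - s) G ≡ ρₚ F G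
    redS s s∈F = ρₚ-same (p─q⊆p F ⁅ s ⁆) (λ h → h)
      (≤-trans (≤-reflexive ρ≡β) (≤-pred (≤-trans β<α (αₚ-del-S F G s))))
      (≤-trans (≤-reflexive (trans ρ≡β β≡)) (+-monoˡ-≤ (q G) rF≤))
      where
      rF≤ : r F ≤ r ((F - s) ∪ A)
      rF≤ with s ∈? A
      ... | yes s∈A = MR.ρ-mono (⊆-trans (⊆-del-add F s)
                        (∪-mono (λ h → h) (λ h → subst (_∈ A) (sym (x∈⁅y⁆⇒x≡y s h)) s∈A)))
      ... | no s∉A = ≤-trans (≮⇒≥ λ lt → s∉A (coloops-in-A s (MR.rank-drop⇒coloop s∈F lt))) (MR.ρ-mono (p⊆p∪q A))
    raiseS : ∀ s → s ∉ F → ρₚ F G < ρₚ (F ∪ ⁅ s ⁆) G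
    raiseS s s∉F = ρₚ-raise
      (subst (_< αₚ (F ∪ ⁅ s ⁆) G) (sym ρ≡β) (<-≤-trans β<α (αₚ-mono (p⊆p∪q ⁅ s ⁆) (λ h → h))))
      (subst (_< βₚ (F ∪ ⁅ s ⁆) G) (sym (trans ρ≡β β≡))
        (+-monoˡ-< (q G) (<-≤-trans (proj₂ (MR.flat⇒rankFlat flatM) s ∈⊤ s∉F) (MR.ρ-mono (p⊆p∪q A)))))
    redT : ∀ t → t ∈ G → ρₚ F (G - t) ≡ ρₚ F G
    redT t t∈G = ρₚ-same (λ h → h) (p─q⊆p G ⁅ t ⁆)
      (≤-trans (≤-reflexive ρ≡β) (≤-pred (≤-trans β<α (αₚ-del-T F G t))))
      (≤-reflexive (trans ρ≡β (cong (r (F ∪ A) +_) (sym (NR.cyclic⇒rankCyclic cyclicN t t∈G)))))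
    raiseT : ∀ t → t ∉ G → ρₚ F G < ρₚ F (G ∪ ⁅ t ⁆)
    raiseT t t∉G = ρₚ-raise
      (subst (_< αₚ F (G ∪ ⁅ t ⁆)) (sym ρ≡β) (<-≤-trans β<α (αₚ-mono (λ h → h) (p⊆p∪q ⁅ t ⁆))))
      (subst (_< βₚ F (G ∪ ⁅ t ⁆)) (sym ρ≡β) (+-monoʳ-< (r (F ∪ A)) (proj₂ (NR.flat⇒rankFlat flatN) t ∈⊤ t∉G)))

  -- Third kind: both α and β equal r F + q G, and both inherit the conditions
  -- from the cyclic flats F of M and G of N.
  kind₃⇒pair : ∀ F G → Kind₃ F G → CyclicFlatPair F G
  kind₃⇒pair F G ((flatM , cyclicM) , A⊆F , (flatN , cyclicN) , G∩B≡⊥) = redS , redT , raiseS , raiseT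
    where
    G∩B≡∅ : ∀ {t} → t ∈ G → t ∉ B
    G∩B≡∅ {t} t∈G t∈B = ∉⊥ (subst (t ∈_) G∩B≡⊥ (x∈p∩q⁺ (t∈G , t∈B)))
    ρ≡r+q : ρₚ F G ≡ r F + q G
    ρ≡r+q = trans (cong₂ _⊓_ (αₚ-off-B F G G∩B≡∅) (βₚ-over-A F G A⊆F)) (⊓-idem _)
    r≤r∪A : ∀ X → r X ≤ r (X ∪ A)
    r≤r∪A X = MR.ρ-mono (p⊆p∪q A)
    raiseM : ∀ s → s ∈ ⊤ → s ∉ F → r F < r (F ∪ ⁅ s ⁆)
    raiseM = proj₂ (MR.flat⇒rankFlat flatM)
    raiseN : ∀ t → t ∈ ⊤ → t ∉ G → q G < q (G ∪ ⁅ t ⁆)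
    raiseN = proj₂ (NR.flat⇒rankFlat flatN)
    redS : ∀ s → s ∈ F → ρₚ (F - s) G ≡ ρₚ F G
    redS s s∈F = ρₚ-same (p─q⊆p F ⁅ s ⁆) (λ h → h)
      (≤-reflexive (trans ρ≡r+q (trans (cong (_+ q G) (sym r-same)) (sym (αₚ-off-B (F - s) G G∩B≡∅)))))
      (≤-trans (≤-reflexive (trans ρ≡r+q (cong (_+ q G) (sym r-same)))) (+-monoˡ-≤ (q G) (r≤r∪A (F - s))))
      where
      r-same : r (F - s) ≡ r F
      r-same = MR.cyclic⇒rankCyclic cyclicM s s∈F
    raiseS : ∀ s → s ∉ F → ρₚ F G < ρₚ (F ∪ ⁅ s ⁆) G
    raiseS s s∉F = ρₚ-raise
      (subst₂ _<_ (sym ρ≡r+q) (sym (αₚ-off-B (F ∪ ⁅ s ⁆) G G∩B≡∅)) (+-monoˡ-< (q G) (raiseM s ∈⊤ s∉F)))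
      (subst (_< βₚ (F ∪ ⁅ s ⁆) G) (sym ρ≡r+q) (+-monoˡ-< (q G) (<-≤-trans (raiseM s ∈⊤ s∉F) (r≤r∪A _))))
    redT : ∀ t → t ∈ G → ρₚ F (G - t) ≡ ρₚ F G
    redT t t∈G = ρₚ-same (λ h → h) (p─q⊆p G ⁅ t ⁆)
      (≤-reflexive (trans ρ≡r+q (trans (cong (r F +_) (sym q-same))
                                       (sym (αₚ-off-B F (G - t) (λ h → G∩B≡∅ (proj₁ (x∈p-y⁻ G h))))))))
      (≤-trans (≤-reflexive (trans ρ≡r+q (cong (r F +_) (sym q-same)))) (+-monoˡ-≤ (q (G - t)) (r≤r∪A F)))
      where
      q-same : q (G - t) ≡ q G
      q-same = NR.cyclic⇒rankCyclic cyclicN t t∈G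
    raiseT : ∀ t → t ∉ G → ρₚ F G < ρₚ F (G ∪ ⁅ t ⁆)
    raiseT t t∉G = ρₚ-raise
      (subst (_< αₚ F (G ∪ ⁅ t ⁆)) (sym ρ≡r+q) (αₚ-raise-T F G t G∩B≡∅ (λ _ → raiseN t ∈⊤ t∉G)))
      (subst (_< βₚ F (G ∪ ⁅ t ⁆)) (sym ρ≡r+q)
        (<-≤-trans (+-monoʳ-< (r F) (raiseN t ∈⊤ t∉G)) (+-monoˡ-≤ (q (G ∪ ⁅ t ⁆)) (r≤r∪A F))))

  OfKind : (Subset m → Subset n → Set) → Subset (m + n) → Set
  OfKind K Z = ∃[ F ] ∃[ G ] (Z ≡ F ++ G × K F G)

  cyclicFlat⇔kinds : ∀ F G → CyclicFlat IP (F ++ G) ⇔ (Kind₁ F G ⊎ Kind₂ F G ⊎ Kind₃ F G)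
  cyclicFlat⇔kinds F G = mk⇔
    (λ cf → pair⇒kind F G (Equivalence.to (cyclicFlat⇔pair F G) cf))
    (λ kind → Equivalence.from (cyclicFlat⇔pair F G) (kind⇒pair kind))
    where
    kind⇒pair : Kind₁ F G ⊎ Kind₂ F G ⊎ Kind₃ F G → CyclicFlatPair F G
    kind⇒pair (inj₁ k) = kind₁⇒pair F G k
    kind⇒pair (inj₂ (inj₁ k)) = kind₂⇒pair F G k
    kind⇒pair (inj₂ (inj₂ k)) = kind₃⇒pair F G k

theorem3p12 : ∀ {m n : ℕ} (M : Matroid m) (N : Matroid n) (A : Subset m) (B : Subset n)
  (Z : Subset (m + n)) →
  CyclicFlat (IndepP M N A B) Z
  ⇔
  ((∃[ ZM ] ∃[ ZN ] (Z ≡ ZM ++ ZN × CyclicFlat (Indep M) ZM × ¬ (A ⊆ ZM)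
      × CyclicFlatIn (Indep N) (∁ B) ZN))
   ⊎ (∃[ FM ] ∃[ ZN ] (Z ≡ FM ++ ZN × Flat (Indep M) FM × A ⊆ FM
      × (∀ x → ColoopIn (Indep M) FM x → x ∈ A)
      × CyclicFlat (Indep N) ZN × ZN ∩ B ≢ ⊥))
   ⊎ (∃[ ZM ] ∃[ ZN ] (Z ≡ ZM ++ ZN × CyclicFlat (Indep M) ZM × A ⊆ ZM
      × CyclicFlat (Indep N) ZN × ZN ∩ B ≡ ⊥)))
theorem3p12 {m} {n} M N A B Z = mk⇔ classify realise
  where
  open Parts m n using (split)
  open ThreeKinds M N A B
  open Equivalence
  classify : CyclicFlat (IndepP M N A B) Z → OfKind Kind₁ Z ⊎ OfKind Kind₂ Z ⊎ OfKind Kind₃ Z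
  classify cyclicFlatZ = label (to (cyclicFlat⇔kinds (take m Z) (drop m Z))
                                  (subst (CyclicFlat (IndepP M N A B)) (split Z) cyclicFlatZ))
    where
    label : Kind₁ (take m Z) (drop m Z) ⊎ Kind₂ (take m Z) (drop m Z) ⊎ Kind₃ (take m Z) (drop m Z) →
            OfKind Kind₁ Z ⊎ OfKind Kind₂ Z ⊎ OfKind Kind₃ Z
    label (inj₁ kind₁) = inj₁ (take m Z , drop m Z , split Z , kind₁)
    label (inj₂ (inj₁ kind₂)) = inj₂ (inj₁ (take m Z , drop m Z , split Z , kind₂))
    label (inj₂ (inj₂ kind₃)) = inj₂ (inj₂ (take m Z , drop m Z , split Z , kind₃))
  realise : OfKind Kind₁ Z ⊎ OfKind Kind₂ Z ⊎ OfKind Kind₃ Z → CyclicFlat (IndepP M N A B) Z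
  realise (inj₁ (F , G , refl , kind₁)) = from (cyclicFlat⇔kinds F G) (inj₁ kind₁)
  realise (inj₂ (inj₁ (F , G , refl , kind₂))) = from (cyclicFlat⇔kinds F G) (inj₂ (inj₁ kind₂))
  realise (inj₂ (inj₂ (F , G , refl , kind₃))) = from (cyclicFlat⇔kinds F G) (inj₂ (inj₂ kind₃))
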